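{- Let $p>3$ be a prime, $r\in\{1,2,\dots,p-1\}$ and $t\in\mathbb{Z}_p$. Then $$\binom{pt+r-1}{\frac{p-1}2}\binom{ -pt-r-1}{\frac{p-1}2}\equiv\begin{cases}\frac{pt}r+\frac{p^2t}r\big(2q_p(2)+H_{\frac{p-1}2-r}\big)-\frac{p^2t^2}{r^2}\pmod{p^3}&\text{if }r<\frac p2,\\ \frac{p(t+1)}r+\frac{p^2(t+1)}r\big(2q_p(2)+H_{r-\frac{p+1}2}\big)-\frac{p^2t(t+1)}{r^2}\pmod{p^3}&\text{if }r>\frac p2.\end{cases}$$
   Context: $\mathbb{Z}_p$ denotes the set of rational numbers whose denominator is not divisible by $p$; congruences modulo $p^m$ are taken in $\mathbb{Z}_p$. $\binom xk=x(x-1)\cdots(x-k+1)/k!$. $q_p(2)=(2^{p-1}-1)/p$. $H_n=\sum_{k=1}^n\frac1k$ for $n\ge1$ and $H_0=0$. -}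

module Defs where

open import Data.Nat as ℕ using (ℕ; zero; suc)
open import Data.Nat.Divisibility using (_∣_)
open import Data.Integer using (+_)
open import Data.Rational as ℚ using (ℚ; 0ℚ; 1ℚ; _+_; _*_; _-_)
open import Data.Product using (Σ; _×_)
open import Relation.Nullary using (¬_)
open import Relation.Binary.PropositionalEquality using (_≡_)

ℕ→ℚ : ℕ → ℚ
ℕ→ℚ n = ℚ._/_ (+ n) 1

-- 1/n for n ≥ 1 (convention: 0 for n = 0; only used with n ≥ 1)
inv : ℕ → ℚ
inv zero = 0ℚ
inv (suc n) = ℚ._/_ (+ 1) (suc n)

pIntegral : ℕ → ℚ → Set
pIntegral p x = ¬ (p ∣ ℚ.denominatorℕ x)

CongMod : ℚ → ℚ → ℕ → ℕ → Set
CongMod a b p m = Σ ℚ λ z → pIntegral p z × (a - b ≡ ℕ→ℚ (p ℕ.^ m) * z)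

falling : ℚ → ℕ → ℚ
falling x zero = 1ℚ
falling x (suc k) = falling x k * (x - ℕ→ℚ k)

binom : ℚ → ℕ → ℚ
binom x k = falling x k * inv (k ℕ.!)

H : ℕ → ℚ
H zero = 0ℚ
H (suc n) = H n + inv (suc n)

qp2 : ℕ → ℚ
qp2 p = (ℕ→ℚ (2 ℕ.^ (p ℕ.∸ 1)) - 1ℚ) * inv p

{-# OPTIONS --safe #-}
-- Write x = p t and h = (p - 1)/2. For r < p/2 the only factor of (x + r - 1) ⋯ (x + r - h) divisible
-- by p is x itself; every other factor of both falling factorials has the form c ± x with c a p-adic
-- unit and is expanded to first order, c (1 + x/c) mod p². Hence (h!)² · lhs ≡ x · K (1 + x S) (mod p³)
-- for an explicit product K of factorials and sum S of reciprocals. Wilson-type expansions of (p - 1)!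
-- give K ≡ (h!)² r⁻¹ (1 + p (H_{h-r} + 2 q_p(2))) (mod p²), the Fermat quotient entering through
-- (p - 1)! = 2^h h! · 1 · 3 ⋯ (p - 2); and S ≡ -1/r (mod p) since H_a ≡ H_{p-1-a} (mod p).
-- The case r > p/2 reduces to this one: the left side is unchanged under (t, r) ↦ (-t-1, p-r), and
-- the two right sides agree modulo p³.
module Submission where

open import Defs
open import Data.Empty using (⊥-elim)
open import Data.Integer as ℤ using (ℤ)
import Data.Integer.Properties as ℤP
import Data.Integer.Tactic.RingSolver as ℤ-Solver
open import Data.Maybe using (Maybe; nothing; just)
open import Data.Nat as ℕ using (ℕ; zero; suc; _<_; _≤_; _!)
import Data.Nat.Coprimality as Coprimality
open import Data.Nat.Divisibility as ℕ∣ using (_∣_; ∣-trans; divides)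
open import Data.Nat.DivMod using (m≡m%n+[m/n]*n; m%n<n; m*n/n≡m)
open import Data.Nat.Primality using (Prime; euclidsLemma; prime⇒irreducible; ¬prime[0]; ¬prime[1])
import Data.Nat.Properties as ℕP
import Data.Nat.Tactic.RingSolver as ℕ-Solver
open import Data.Product using (_×_; _,_)
open import Data.Rational as ℚ using (ℚ; _+_; _*_; _-_; -_; 1ℚ; 0ℚ; mkℚ)
import Data.Rational.Properties as ℚP
import Data.Rational.Unnormalised as ℚᵘ
import Data.Rational.Unnormalised.Properties as ℚᵘP
open import Data.Sum using (inj₁; inj₂)
open import Level using (0ℓ)
open import Relation.Binary.Bundles using (Setoid)
open import Relation.Binary.PropositionalEquality
open import Relation.Nullary using (¬_; yes; no)
open import Tactic.RingSolver using (solve-∀)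
open import Tactic.RingSolver.Core.AlmostCommutativeRing using (AlmostCommutativeRing; fromCommutativeRing)

ℚ-ring : AlmostCommutativeRing 0ℓ 0ℓ
ℚ-ring = fromCommutativeRing ℚP.+-*-commutativeRing isZero
  where
  isZero : ∀ x → Maybe (0ℚ ≡ x)
  isZero x with 0ℚ ℚP.≟ x
  ... | yes 0≡x = just 0≡x
  ... | no _ = nothing

ℤ→ℚ : ℤ → ℚ
ℤ→ℚ i = i ℚ./ 1

toℚᵘ-ℤ→ℚ : ∀ i → ℚ.toℚᵘ (ℤ→ℚ i) ℚᵘ.≃ ℚᵘ.mkℚᵘ i 0
toℚᵘ-ℤ→ℚ i = ℚP.toℚᵘ-fromℚᵘ (ℚᵘ.mkℚᵘ i 0)

ℤ→ℚ-+ : ∀ i j → ℤ→ℚ (i ℤ.+ j) ≡ ℤ→ℚ i + ℤ→ℚ j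
ℤ→ℚ-+ i j = ℚP.toℚᵘ-injective (begin
  ℚ.toℚᵘ (ℤ→ℚ (i ℤ.+ j))                   ≈⟨ toℚᵘ-ℤ→ℚ (i ℤ.+ j) ⟩
  ℚᵘ.mkℚᵘ (i ℤ.+ j) 0                       ≈⟨ ℚᵘ.*≡* (homo i j) ⟩
  ℚᵘ.mkℚᵘ i 0 ℚᵘ.+ ℚᵘ.mkℚᵘ j 0              ≈⟨ ℚᵘP.+-cong (toℚᵘ-ℤ→ℚ i) (toℚᵘ-ℤ→ℚ j) ⟨
  ℚ.toℚᵘ (ℤ→ℚ i) ℚᵘ.+ ℚ.toℚᵘ (ℤ→ℚ j)      ≈⟨ ℚP.toℚᵘ-homo-+ (ℤ→ℚ i) (ℤ→ℚ j) ⟨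
  ℚ.toℚᵘ (ℤ→ℚ i + ℤ→ℚ j)                   ∎)
  where
  open ℚᵘP.≃-Reasoning
  homo : ∀ i j → (i ℤ.+ j) ℤ.* ℤ.+ 1 ≡ (i ℤ.* ℤ.+ 1 ℤ.+ j ℤ.* ℤ.+ 1) ℤ.* ℤ.+ 1
  homo = ℤ-Solver.solve-∀

ℤ→ℚ-* : ∀ i j → ℤ→ℚ (i ℤ.* j) ≡ ℤ→ℚ i * ℤ→ℚ j
ℤ→ℚ-* i j = ℚP.toℚᵘ-injective (begin
  ℚ.toℚᵘ (ℤ→ℚ (i ℤ.* j))                   ≈⟨ toℚᵘ-ℤ→ℚ (i ℤ.* j) ⟩
  ℚᵘ.mkℚᵘ (i ℤ.* j) 0                       ≈⟨ ℚᵘP.*-cong (toℚᵘ-ℤ→ℚ i) (toℚᵘ-ℤ→ℚ j) ⟨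
  ℚ.toℚᵘ (ℤ→ℚ i) ℚᵘ.* ℚ.toℚᵘ (ℤ→ℚ j)      ≈⟨ ℚP.toℚᵘ-homo-* (ℤ→ℚ i) (ℤ→ℚ j) ⟨
  ℚ.toℚᵘ (ℤ→ℚ i * ℤ→ℚ j)                   ∎)
  where open ℚᵘP.≃-Reasoning

ℕ→ℚ-+ : ∀ m n → ℕ→ℚ (m ℕ.+ n) ≡ ℕ→ℚ m + ℕ→ℚ n
ℕ→ℚ-+ m n = trans (cong ℤ→ℚ (ℤP.pos-+ m n)) (ℤ→ℚ-+ (ℤ.+ m) (ℤ.+ n))

ℕ→ℚ-* : ∀ m n → ℕ→ℚ (m ℕ.* n) ≡ ℕ→ℚ m * ℕ→ℚ n
ℕ→ℚ-* m n = trans (cong ℤ→ℚ (ℤP.pos-* m n)) (ℤ→ℚ-* (ℤ.+ m) (ℤ.+ n))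

ℕ→ℚ-suc : ∀ n → ℕ→ℚ (suc n) ≡ ℕ→ℚ n + 1ℚ
ℕ→ℚ-suc n = trans (cong ℕ→ℚ (ℕP.+-comm 1 n)) (ℕ→ℚ-+ n 1)

ℕ→ℚ-∸ : ∀ {m n} → n ≤ m → ℕ→ℚ (m ℕ.∸ n) ≡ ℕ→ℚ m - ℕ→ℚ n
ℕ→ℚ-∸ {m} {n} n≤m = begin
  ℕ→ℚ (m ℕ.∸ n)                       ≡⟨ cancel (ℕ→ℚ (m ℕ.∸ n)) (ℕ→ℚ n) ⟨
  ℕ→ℚ (m ℕ.∸ n) + ℕ→ℚ n - ℕ→ℚ n       ≡⟨ cong (_- ℕ→ℚ n) (ℕ→ℚ-+ (m ℕ.∸ n) n) ⟨
  ℕ→ℚ (m ℕ.∸ n ℕ.+ n) - ℕ→ℚ n         ≡⟨ cong (λ k → ℕ→ℚ k - ℕ→ℚ n) (ℕP.m∸n+n≡m n≤m) ⟩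
  ℕ→ℚ m - ℕ→ℚ n                       ∎
  where
  open ≡-Reasoning
  cancel : ∀ a b → a + b - b ≡ a
  cancel = solve-∀ ℚ-ring

inv-inverseˡ : ∀ n → inv (suc n) * ℕ→ℚ (suc n) ≡ 1ℚ
inv-inverseˡ n = ℚP.toℚᵘ-injective (begin
  ℚ.toℚᵘ (inv (suc n) * ℕ→ℚ (suc n))                 ≈⟨ ℚP.toℚᵘ-homo-* (inv (suc n)) (ℕ→ℚ (suc n)) ⟩
  ℚ.toℚᵘ (inv (suc n)) ℚᵘ.* ℚ.toℚᵘ (ℕ→ℚ (suc n))     ≈⟨ ℚᵘP.*-cong (ℚP.toℚᵘ-fromℚᵘ (ℚᵘ.mkℚᵘ (ℤ.+ 1) n)) (toℚᵘ-ℤ→ℚ (ℤ.+ suc n)) ⟩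
  ℚᵘ.mkℚᵘ (ℤ.+ 1) n ℚᵘ.* ℚᵘ.mkℚᵘ (ℤ.+ suc n) 0       ≈⟨ ℚᵘ.*≡* cross ⟩
  ℚᵘ.1ℚᵘ                                              ∎)
  where
  open ℚᵘP.≃-Reasoning
  cross : (ℤ.+ 1 ℤ.* ℤ.+ suc n) ℤ.* ℤ.+ 1 ≡ ℤ.+ 1 ℤ.* ℤ.+ (suc n ℕ.* 1)
  cross = trans (ℤP.*-identityʳ _) (cong (λ k → ℤ.+ 1 ℤ.* ℤ.+ k) (sym (ℕP.*-identityʳ (suc n))))

-- Finite products and sums, falling factorials, harmonic numbers

∏ : (ℕ → ℚ) → ℕ → ℚ
∏ f zero = 1ℚ
∏ f (suc n) = ∏ f n * f n

∑ : (ℕ → ℚ) → ℕ → ℚ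
∑ f zero = 0ℚ
∑ f (suc n) = ∑ f n + f n

∏-cong : ∀ {f g} n → (∀ i → i < n → f i ≡ g i) → ∏ f n ≡ ∏ g n
∏-cong zero f≡g = refl
∏-cong (suc n) f≡g = cong₂ _*_ (∏-cong n (λ i i<n → f≡g i (ℕP.m<n⇒m<1+n i<n))) (f≡g n ℕP.≤-refl)

∏-+ : ∀ f m n → ∏ f (m ℕ.+ n) ≡ ∏ f m * ∏ (λ i → f (m ℕ.+ i)) n
∏-+ f m zero = trans (cong (∏ f) (ℕP.+-identityʳ m)) (sym (ℚP.*-identityʳ (∏ f m)))
∏-+ f m (suc n) = begin
  ∏ f (m ℕ.+ suc n)                                          ≡⟨ cong (∏ f) (ℕP.+-suc m n) ⟩
  ∏ f (m ℕ.+ n) * f (m ℕ.+ n)                                ≡⟨ cong (_* f (m ℕ.+ n)) (∏-+ f m n) ⟩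
  ∏ f m * ∏ (λ i → f (m ℕ.+ i)) n * f (m ℕ.+ n)              ≡⟨ ℚP.*-assoc (∏ f m) _ _ ⟩
  ∏ f m * ∏ (λ i → f (m ℕ.+ i)) (suc n)                      ∎
  where open ≡-Reasoning

∏-* : ∀ f g n → ∏ (λ i → f i * g i) n ≡ ∏ f n * ∏ g n
∏-* f g zero = refl
∏-* f g (suc n) = trans (cong (_* (f n * g n)) (∏-* f g n)) (interchange (∏ f n) (∏ g n) (f n) (g n))
  where
  interchange : ∀ a b c d → a * b * (c * d) ≡ a * c * (b * d)
  interchange = solve-∀ ℚ-ring

∏-const : ∀ m n → ∏ (λ _ → ℕ→ℚ m) n ≡ ℕ→ℚ (m ℕ.^ n)
∏-const m zero = refl
∏-const m (suc n) = trans (cong (_* ℕ→ℚ m) (∏-const m n)) (trans (ℚP.*-comm _ (ℕ→ℚ m)) (sym (ℕ→ℚ-* m (m ℕ.^ n))))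

∑-*ˡ : ∀ c f n → ∑ (λ i → c * f i) n ≡ c * ∑ f n
∑-*ˡ c f zero = sym (ℚP.*-zeroʳ c)
∑-*ˡ c f (suc n) = trans (cong (_+ c * f n) (∑-*ˡ c f n)) (sym (ℚP.*-distribˡ-+ c _ _))

sign : ℕ → ℚ
sign = ∏ (λ _ → - 1ℚ)

sign-+ : ∀ m n → sign (m ℕ.+ n) ≡ sign m * sign n
sign-+ = ∏-+ (λ _ → - 1ℚ)

sign-sq : ∀ n → sign n * sign n ≡ 1ℚ
sign-sq zero = refl
sign-sq (suc n) = trans (square-* (sign n) (- 1ℚ)) (cong (_* (- 1ℚ * - 1ℚ)) (sign-sq n))
  where
  square-* : ∀ a b → a * b * (a * b) ≡ a * a * (b * b)
  square-* = solve-∀ ℚ-ring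

fac : ℕ → ℚ
fac n = ℕ→ℚ (n !)

fac-suc : ∀ n → fac (suc n) ≡ ℕ→ℚ (suc n) * fac n
fac-suc n = ℕ→ℚ-* (suc n) (n !)

falling≡∏ : ∀ x n → falling x n ≡ ∏ (λ i → x - ℕ→ℚ i) n
falling≡∏ x zero = refl
falling≡∏ x (suc n) = cong (_* (x - ℕ→ℚ n)) (falling≡∏ x n)

falling-+ : ∀ x m n → falling x (m ℕ.+ n) ≡ falling x m * falling (x - ℕ→ℚ m) n
falling-+ x m n = begin
  falling x (m ℕ.+ n)                                             ≡⟨ falling≡∏ x (m ℕ.+ n) ⟩
  ∏ (λ i → x - ℕ→ℚ i) (m ℕ.+ n)                                   ≡⟨ ∏-+ (λ i → x - ℕ→ℚ i) m n ⟩
  ∏ (λ i → x - ℕ→ℚ i) m * ∏ (λ i → x - ℕ→ℚ (m ℕ.+ i)) n           ≡⟨ cong₂ _*_ (sym (falling≡∏ x m)) (∏-cong n shift) ⟩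
  falling x m * ∏ (λ i → x - ℕ→ℚ m - ℕ→ℚ i) n                      ≡⟨ cong (falling x m *_) (sym (falling≡∏ (x - ℕ→ℚ m) n)) ⟩
  falling x m * falling (x - ℕ→ℚ m) n                              ∎
  where
  open ≡-Reasoning
  sub-+ : ∀ x a b → x - (a + b) ≡ x - a - b
  sub-+ = solve-∀ ℚ-ring
  shift : ∀ i → i < n → x - ℕ→ℚ (m ℕ.+ i) ≡ x - ℕ→ℚ m - ℕ→ℚ i
  shift i _ = trans (cong (λ y → x - y) (ℕ→ℚ-+ m i)) (sub-+ x (ℕ→ℚ m) (ℕ→ℚ i))

falling-suc : ∀ x n → falling x (suc n) ≡ x * falling (x - 1ℚ) n
falling-suc x n = trans (falling-+ x 1 n) (cong (_* falling (x - 1ℚ) n) (lead x))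
  where
  lead : ∀ x → 1ℚ * (x - 0ℚ) ≡ x
  lead = solve-∀ ℚ-ring

falling-ℕ : ∀ n → falling (ℕ→ℚ n) n ≡ fac n
falling-ℕ zero = refl
falling-ℕ (suc n) = begin
  falling (ℕ→ℚ (suc n)) (suc n)                  ≡⟨ falling-suc (ℕ→ℚ (suc n)) n ⟩
  ℕ→ℚ (suc n) * falling (ℕ→ℚ (suc n) - 1ℚ) n     ≡⟨ cong (λ y → ℕ→ℚ (suc n) * falling y n) pred-eq ⟩
  ℕ→ℚ (suc n) * falling (ℕ→ℚ n) n                 ≡⟨ cong (ℕ→ℚ (suc n) *_) (falling-ℕ n) ⟩
  ℕ→ℚ (suc n) * fac n                             ≡⟨ fac-suc n ⟨
  fac (suc n)                                     ∎
  where
  open ≡-Reasoning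
  pred-eq : ℕ→ℚ (suc n) - 1ℚ ≡ ℕ→ℚ n
  pred-eq = sym (ℕ→ℚ-∸ {suc n} {1} (ℕ.s≤s ℕ.z≤n))

falling-ℕ-+ : ∀ m n → falling (ℕ→ℚ (m ℕ.+ n)) n * fac m ≡ fac (m ℕ.+ n)
falling-ℕ-+ m n = begin
  falling (ℕ→ℚ (m ℕ.+ n)) n * fac m                                      ≡⟨ cong (falling (ℕ→ℚ (m ℕ.+ n)) n *_) lower ⟨
  falling (ℕ→ℚ (m ℕ.+ n)) n * falling (ℕ→ℚ (m ℕ.+ n) - ℕ→ℚ n) m          ≡⟨ falling-+ (ℕ→ℚ (m ℕ.+ n)) n m ⟨
  falling (ℕ→ℚ (m ℕ.+ n)) (n ℕ.+ m)                                      ≡⟨ cong (falling (ℕ→ℚ (m ℕ.+ n))) (ℕP.+-comm n m) ⟩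
  falling (ℕ→ℚ (m ℕ.+ n)) (m ℕ.+ n)                                      ≡⟨ falling-ℕ (m ℕ.+ n) ⟩
  fac (m ℕ.+ n)                                                          ∎
  where
  open ≡-Reasoning
  lower : falling (ℕ→ℚ (m ℕ.+ n) - ℕ→ℚ n) m ≡ fac m
  lower = trans (cong (λ y → falling y m) (trans (sym (ℕ→ℚ-∸ (ℕP.m≤n+m n m))) (cong ℕ→ℚ (ℕP.m+n∸n≡m m n))))
                (falling-ℕ m)

falling-neg : ∀ b n → falling (- ℕ→ℚ (suc b)) n * fac b ≡ sign n * fac (b ℕ.+ n)
falling-neg b zero = trans (ℚP.*-identityˡ (fac b)) (trans (cong fac (sym (ℕP.+-identityʳ b))) (sym (ℚP.*-identityˡ _)))
falling-neg b (suc n) = begin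
  falling c n * (c - ℕ→ℚ n) * fac b                          ≡⟨ swap (falling c n) (c - ℕ→ℚ n) (fac b) ⟩
  falling c n * fac b * (c - ℕ→ℚ n)                          ≡⟨ cong₂ _*_ (falling-neg b n) factor ⟩
  sign n * fac (b ℕ.+ n) * (- 1ℚ * ℕ→ℚ (suc (b ℕ.+ n)))     ≡⟨ regroup (sign n) (fac (b ℕ.+ n)) (- 1ℚ) (ℕ→ℚ (suc (b ℕ.+ n))) ⟩
  sign (suc n) * (ℕ→ℚ (suc (b ℕ.+ n)) * fac (b ℕ.+ n))       ≡⟨ cong (λ k → sign (suc n) * k) (sym (fac-suc (b ℕ.+ n))) ⟩
  sign (suc n) * fac (suc (b ℕ.+ n))                          ≡⟨ cong (λ k → sign (suc n) * fac k) (sym (ℕP.+-suc b n)) ⟩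
  sign (suc n) * fac (b ℕ.+ suc n)                            ∎
  where
  open ≡-Reasoning
  c : ℚ
  c = - ℕ→ℚ (suc b)
  swap : ∀ a b c → a * b * c ≡ a * c * b
  swap = solve-∀ ℚ-ring
  regroup : ∀ s f m x → s * f * (m * x) ≡ s * m * (x * f)
  regroup = solve-∀ ℚ-ring
  neg-sum : ∀ b n → - (b + 1ℚ) - n ≡ - 1ℚ * (b + n + 1ℚ)
  neg-sum = solve-∀ ℚ-ring
  factor : c - ℕ→ℚ n ≡ - 1ℚ * ℕ→ℚ (suc (b ℕ.+ n))
  factor = begin
    - ℕ→ℚ (suc b) - ℕ→ℚ n                   ≡⟨ cong (λ y → - y - ℕ→ℚ n) (ℕ→ℚ-suc b) ⟩
    - (ℕ→ℚ b + 1ℚ) - ℕ→ℚ n                  ≡⟨ neg-sum (ℕ→ℚ b) (ℕ→ℚ n) ⟩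
    - 1ℚ * (ℕ→ℚ b + ℕ→ℚ n + 1ℚ)             ≡⟨ cong (λ y → - 1ℚ * (y + 1ℚ)) (ℕ→ℚ-+ b n) ⟨
    - 1ℚ * (ℕ→ℚ (b ℕ.+ n) + 1ℚ)             ≡⟨ cong (- 1ℚ *_) (ℕ→ℚ-suc (b ℕ.+ n)) ⟨
    - 1ℚ * ℕ→ℚ (suc (b ℕ.+ n))              ∎

falling-minus-one : ∀ n → falling (- 1ℚ) n ≡ sign n * fac n
falling-minus-one n = trans (sym (ℚP.*-identityʳ (falling (- 1ℚ) n))) (falling-neg 0 n)

odd-product : ℕ → ℕ
odd-product zero = 1
odd-product (suc n) = odd-product n ℕ.* suc (2 ℕ.* n)

!-double : ∀ n → (n ℕ.+ n) ! ≡ 2 ℕ.^ n ℕ.* n ! ℕ.* odd-product n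
!-double zero = refl
!-double (suc n) = begin
  (suc n ℕ.+ suc n) !                                                    ≡⟨ cong _! (ℕP.+-suc (suc n) n) ⟩
  suc (suc (n ℕ.+ n)) ℕ.* (suc (n ℕ.+ n) ℕ.* (n ℕ.+ n) !)                ≡⟨ cong (λ k → suc (suc (n ℕ.+ n)) ℕ.* (suc (n ℕ.+ n) ℕ.* k)) (!-double n) ⟩
  suc (suc (n ℕ.+ n)) ℕ.* (suc (n ℕ.+ n) ℕ.* (2 ℕ.^ n ℕ.* n ! ℕ.* odd-product n))
                                                                         ≡⟨ regroup n (2 ℕ.^ n) (n !) (odd-product n) ⟩
  2 ℕ.^ suc n ℕ.* suc n ! ℕ.* odd-product (suc n)                        ∎
  where
  open ≡-Reasoning
  regroup : ∀ n e f o → (2 ℕ.+ (n ℕ.+ n)) ℕ.* ((1 ℕ.+ (n ℕ.+ n)) ℕ.* (e ℕ.* f ℕ.* o))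
                        ≡ 2 ℕ.* e ℕ.* ((1 ℕ.+ n) ℕ.* f) ℕ.* (o ℕ.* (1 ℕ.+ 2 ℕ.* n))
  regroup = ℕ-Solver.solve-∀

ℕ→ℚ-odd-product : ∀ n → ℕ→ℚ (odd-product n) ≡ ∏ (λ i → ℕ→ℚ (suc (2 ℕ.* i))) n
ℕ→ℚ-odd-product zero = refl
ℕ→ℚ-odd-product (suc n) = trans (ℕ→ℚ-* (odd-product n) _) (cong (_* ℕ→ℚ (suc (2 ℕ.* n))) (ℕ→ℚ-odd-product n))

∑-inv-∸ : ∀ m n → ∑ (λ i → inv ((m ℕ.+ n) ℕ.∸ i)) n ≡ H (m ℕ.+ n) - H m
∑-inv-∸ m zero = trans (sym (ℚP.+-inverseʳ (H m))) (cong (λ k → H k - H m) (sym (ℕP.+-identityʳ m)))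
∑-inv-∸ m (suc n) = begin
  ∑ (λ i → inv ((m ℕ.+ suc n) ℕ.∸ i)) n + inv ((m ℕ.+ suc n) ℕ.∸ n)
      ≡⟨ cong₂ (λ k l → ∑ (λ i → inv (k ℕ.∸ i)) n + inv l) m+1+n top ⟩
  ∑ (λ i → inv ((suc m ℕ.+ n) ℕ.∸ i)) n + inv (suc m)
      ≡⟨ cong (_+ inv (suc m)) (∑-inv-∸ (suc m) n) ⟩
  H (suc m ℕ.+ n) - (H m + inv (suc m)) + inv (suc m)
      ≡⟨ telescope (H (suc m ℕ.+ n)) (H m) (inv (suc m)) ⟩
  H (suc m ℕ.+ n) - H m
      ≡⟨ cong (λ k → H k - H m) (sym m+1+n) ⟩
  H (m ℕ.+ suc n) - H m ∎
  where
  open ≡-Reasoning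
  m+1+n : m ℕ.+ suc n ≡ suc m ℕ.+ n
  m+1+n = ℕP.+-suc m n
  top : (m ℕ.+ suc n) ℕ.∸ n ≡ suc m
  top = trans (cong (ℕ._∸ n) m+1+n) (ℕP.m+n∸n≡m (suc m) n)
  telescope : ∀ a b c → a - (b + c) + c ≡ a - b
  telescope = solve-∀ ℚ-ring

∑-neg-inv : ∀ b n → ∑ (λ i → - inv (suc (b ℕ.+ i))) n ≡ H b - H (b ℕ.+ n)
∑-neg-inv b zero = trans (sym (ℚP.+-inverseʳ (H b))) (cong (λ k → H b - H k) (sym (ℕP.+-identityʳ b)))
∑-neg-inv b (suc n) = begin
  ∑ (λ i → - inv (suc (b ℕ.+ i))) n - inv (suc (b ℕ.+ n))   ≡⟨ cong (_- inv (suc (b ℕ.+ n))) (∑-neg-inv b n) ⟩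
  H b - H (b ℕ.+ n) - inv (suc (b ℕ.+ n))                   ≡⟨ assoc (H b) (H (b ℕ.+ n)) (inv (suc (b ℕ.+ n))) ⟩
  H b - H (suc (b ℕ.+ n))                                   ≡⟨ cong (λ k → H b - H k) (sym (ℕP.+-suc b n)) ⟩
  H b - H (b ℕ.+ suc n)                                     ∎
  where
  open ≡-Reasoning
  assoc : ∀ a b c → a - b - c ≡ a - (b + c)
  assoc = solve-∀ ℚ-ring

-- binom (x - 1) k * binom (- x - 1) k is even in x; here x = q t + R = - (q t′ + S) with t′ = - (t + 1).
binom-product-reflect : ∀ q t R S k → R + S ≡ q →
  binom (q * t + R - 1ℚ) k * binom (- (q * t) - R - 1ℚ) k
    ≡ binom (q * - (t + 1ℚ) + S - 1ℚ) k * binom (- (q * - (t + 1ℚ)) - S - 1ℚ) k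
binom-product-reflect q t R S k R+S≡q = begin
  binom (q * t + R - 1ℚ) k * binom (- (q * t) - R - 1ℚ) k
    ≡⟨ ℚP.*-comm (binom (q * t + R - 1ℚ) k) _ ⟩
  binom (- (q * t) - R - 1ℚ) k * binom (q * t + R - 1ℚ) k
    ≡⟨ cong₂ (λ x y → binom x k * binom y k) (first q t R) (second q t R) ⟩
  binom (q * - (t + 1ℚ) + (q - R) - 1ℚ) k * binom (- (q * - (t + 1ℚ)) - (q - R) - 1ℚ) k
    ≡⟨ cong (λ y → binom (q * - (t + 1ℚ) + y - 1ℚ) k * binom (- (q * - (t + 1ℚ)) - y - 1ℚ) k) S≡q-R ⟨
  binom (q * - (t + 1ℚ) + S - 1ℚ) k * binom (- (q * - (t + 1ℚ)) - S - 1ℚ) k ∎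
  where
  open ≡-Reasoning
  first : ∀ q t R → - (q * t) - R - 1ℚ ≡ q * - (t + 1ℚ) + (q - R) - 1ℚ
  first = solve-∀ ℚ-ring
  second : ∀ q t R → q * t + R - 1ℚ ≡ - (q * - (t + 1ℚ)) - (q - R) - 1ℚ
  second = solve-∀ ℚ-ring
  cancel : ∀ R S → R + S - R ≡ S
  cancel = solve-∀ ℚ-ring
  S≡q-R : S ≡ q - R
  S≡q-R = trans (sym (cancel R S)) (cong (_- R) R+S≡q)

-- p-integral rationals and congruences modulo powers of p

module Modulo (p : ℕ) (p-prime : Prime p) where

  P : ℚ
  P = ℕ→ℚ p

  record ℤₚ (x : ℚ) : Set where
    constructor ℤₚ✓
    field denominator-coprime : pIntegral p x
  open ℤₚ public

  p∤1 : ¬ p ∣ 1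
  p∤1 p∣1 = ¬prime[1] (subst Prime (ℕ∣.∣1⇒≡1 p∣1) p-prime)

  p∤-* : ∀ {m n} → ¬ p ∣ m → ¬ p ∣ n → ¬ p ∣ (m ℕ.* n)
  p∤-* {m} {n} p∤m p∤n p∣mn with euclidsLemma m n p-prime p∣mn
  ... | inj₁ p∣m = p∤m p∣m
  ... | inj₂ p∣n = p∤n p∣n

  p∤-< : ∀ {n} → 0 < n → n < p → ¬ p ∣ n
  p∤-< {suc n} _ n<p p∣n = ℕP.<⇒≱ n<p (ℕ∣.∣⇒≤ p∣n)

  p∤! : ∀ {n} → n < p → ¬ p ∣ (n !)
  p∤! {zero} _ = p∤1
  p∤! {suc n} n<p = p∤-* (p∤-< (ℕ.s≤s ℕ.z≤n) n<p) (p∤! (ℕP.<-trans (ℕP.n<1+n n) n<p))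

  fraction⇒ℤₚ : ∀ {x} (a : ℤ) (b : ℕ) → ¬ p ∣ b → x * ℕ→ℚ b ≡ ℤ→ℚ a → ℤₚ x
  fraction⇒ℤₚ {x@(mkℚ n d-1 coprime)} a b p∤b x*b≡a = ℤₚ✓ (λ p∣d → p∤b (∣-trans p∣d d∣b))
    where
    d : ℕ
    d = suc d-1
    unnormalised : ℚᵘ.mkℚᵘ n d-1 ℚᵘ.* ℚᵘ.mkℚᵘ (ℤ.+ b) 0 ℚᵘ.≃ ℚᵘ.mkℚᵘ a 0
    unnormalised = begin
      ℚᵘ.mkℚᵘ n d-1 ℚᵘ.* ℚᵘ.mkℚᵘ (ℤ.+ b) 0     ≈⟨ ℚᵘP.*-congˡ {ℚᵘ.mkℚᵘ n d-1} (toℚᵘ-ℤ→ℚ (ℤ.+ b)) ⟨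
      ℚᵘ.mkℚᵘ n d-1 ℚᵘ.* ℚ.toℚᵘ (ℕ→ℚ b)       ≈⟨ ℚP.toℚᵘ-homo-* x (ℕ→ℚ b) ⟨
      ℚ.toℚᵘ (x * ℕ→ℚ b)                      ≈⟨ ℚP.toℚᵘ-cong x*b≡a ⟩
      ℚ.toℚᵘ (ℤ→ℚ a)                          ≈⟨ toℚᵘ-ℤ→ℚ a ⟩
      ℚᵘ.mkℚᵘ a 0                             ∎
      where open ℚᵘP.≃-Reasoning
    cross : n ℤ.* ℤ.+ b ≡ a ℤ.* ℤ.+ d
    cross = begin
      n ℤ.* ℤ.+ b                 ≡⟨ ℤP.*-identityʳ _ ⟨
      n ℤ.* ℤ.+ b ℤ.* ℤ.+ 1       ≡⟨ ℚᵘP.drop-*≡* unnormalised ⟩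
      a ℤ.* ℤ.+ (d ℕ.* 1)          ≡⟨ cong (λ k → a ℤ.* ℤ.+ k) (ℕP.*-identityʳ d) ⟩
      a ℤ.* ℤ.+ d                  ∎
      where open ≡-Reasoning
    d∣b : d ∣ b
    d∣b = Coprimality.coprime-divisor (Coprimality.sym (Coprimality.recompute coprime))
            (divides ℤ.∣ a ∣ (trans (sym (ℤP.abs-* n (ℤ.+ b))) (trans (cong ℤ.∣_∣ cross) (ℤP.abs-* a (ℤ.+ d)))))

  record Fraction (x : ℚ) : Set where
    field
      num : ℤ
      den : ℕ
      p∤den : ¬ p ∣ den
      clears : x * ℕ→ℚ den ≡ ℤ→ℚ num

  ℤₚ⇒fraction : ∀ {x} → ℤₚ x → Fraction x
  ℤₚ⇒fraction {x@(mkℚ n d-1 _)} (ℤₚ✓ p∤d) = record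
    { num = n ; den = suc d-1 ; p∤den = p∤d
    ; clears = ℚP.toℚᵘ-injective (begin
        ℚ.toℚᵘ (x * ℕ→ℚ (suc d-1))                     ≈⟨ ℚP.toℚᵘ-homo-* x (ℕ→ℚ (suc d-1)) ⟩
        ℚᵘ.mkℚᵘ n d-1 ℚᵘ.* ℚ.toℚᵘ (ℕ→ℚ (suc d-1))     ≈⟨ ℚᵘP.*-congˡ {ℚᵘ.mkℚᵘ n d-1} (toℚᵘ-ℤ→ℚ (ℤ.+ suc d-1)) ⟩
        ℚᵘ.mkℚᵘ n d-1 ℚᵘ.* ℚᵘ.mkℚᵘ (ℤ.+ suc d-1) 0   ≈⟨ ℚᵘ.*≡* cross ⟩
        ℚᵘ.mkℚᵘ n 0                                    ≈⟨ toℚᵘ-ℤ→ℚ n ⟨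
        ℚ.toℚᵘ (ℤ→ℚ n)                                 ∎) }
    where
    open ℚᵘP.≃-Reasoning
    cross : (n ℤ.* ℤ.+ suc d-1) ℤ.* ℤ.+ 1 ≡ n ℤ.* ℤ.+ (suc d-1 ℕ.* 1)
    cross = trans (ℤP.*-identityʳ _) (cong (λ k → n ℤ.* ℤ.+ k) (sym (ℕP.*-identityʳ (suc d-1))))

  ℤₚ-ℤ : ∀ a → ℤₚ (ℤ→ℚ a)
  ℤₚ-ℤ a = fraction⇒ℤₚ a 1 p∤1 (ℚP.*-identityʳ (ℤ→ℚ a))

  ℤₚ-ℕ : ∀ n → ℤₚ (ℕ→ℚ n)
  ℤₚ-ℕ n = ℤₚ-ℤ (ℤ.+ n)

  ℤₚ-0 : ℤₚ 0ℚ
  ℤₚ-0 = ℤₚ-ℕ 0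

  ℤₚ-1 : ℤₚ 1ℚ
  ℤₚ-1 = ℤₚ-ℕ 1

  ℤₚ-+ : ∀ {x y} → ℤₚ x → ℤₚ y → ℤₚ (x + y)
  ℤₚ-+ {x} {y} x∈ y∈ = fraction⇒ℤₚ (a ℤ.* ℤ.+ b′ ℤ.+ a′ ℤ.* ℤ.+ b) (b ℕ.* b′) (p∤-* p∤b p∤b′) (begin
    (x + y) * ℕ→ℚ (b ℕ.* b′)                          ≡⟨ cong ((x + y) *_) (ℕ→ℚ-* b b′) ⟩
    (x + y) * (ℕ→ℚ b * ℕ→ℚ b′)                        ≡⟨ expand x y (ℕ→ℚ b) (ℕ→ℚ b′) ⟩
    x * ℕ→ℚ b * ℕ→ℚ b′ + y * ℕ→ℚ b′ * ℕ→ℚ b           ≡⟨ cong₂ (λ u v → u * ℕ→ℚ b′ + v * ℕ→ℚ b) x*b y*b′ ⟩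
    ℤ→ℚ a * ℕ→ℚ b′ + ℤ→ℚ a′ * ℕ→ℚ b                   ≡⟨ cong₂ _+_ (ℤ→ℚ-* a (ℤ.+ b′)) (ℤ→ℚ-* a′ (ℤ.+ b)) ⟨
    ℤ→ℚ (a ℤ.* ℤ.+ b′) + ℤ→ℚ (a′ ℤ.* ℤ.+ b)           ≡⟨ ℤ→ℚ-+ (a ℤ.* ℤ.+ b′) (a′ ℤ.* ℤ.+ b) ⟨
    ℤ→ℚ (a ℤ.* ℤ.+ b′ ℤ.+ a′ ℤ.* ℤ.+ b)               ∎)
    where
    open ≡-Reasoning
    open Fraction (ℤₚ⇒fraction x∈) renaming (num to a; den to b; p∤den to p∤b; clears to x*b)
    open Fraction (ℤₚ⇒fraction y∈) renaming (num to a′; den to b′; p∤den to p∤b′; clears to y*b′)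
    expand : ∀ x y b b′ → (x + y) * (b * b′) ≡ x * b * b′ + y * b′ * b
    expand = solve-∀ ℚ-ring

  ℤₚ-* : ∀ {x y} → ℤₚ x → ℤₚ y → ℤₚ (x * y)
  ℤₚ-* {x} {y} x∈ y∈ = fraction⇒ℤₚ (a ℤ.* a′) (b ℕ.* b′) (p∤-* p∤b p∤b′) (begin
    x * y * ℕ→ℚ (b ℕ.* b′)              ≡⟨ cong (x * y *_) (ℕ→ℚ-* b b′) ⟩
    x * y * (ℕ→ℚ b * ℕ→ℚ b′)            ≡⟨ interchange x y (ℕ→ℚ b) (ℕ→ℚ b′) ⟩
    x * ℕ→ℚ b * (y * ℕ→ℚ b′)            ≡⟨ cong₂ _*_ x*b y*b′ ⟩
    ℤ→ℚ a * ℤ→ℚ a′                      ≡⟨ ℤ→ℚ-* a a′ ⟨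
    ℤ→ℚ (a ℤ.* a′)                      ∎)
    where
    open ≡-Reasoning
    open Fraction (ℤₚ⇒fraction x∈) renaming (num to a; den to b; p∤den to p∤b; clears to x*b)
    open Fraction (ℤₚ⇒fraction y∈) renaming (num to a′; den to b′; p∤den to p∤b′; clears to y*b′)
    interchange : ∀ x y b b′ → x * y * (b * b′) ≡ x * b * (y * b′)
    interchange = solve-∀ ℚ-ring

  ℤₚ-neg : ∀ {x} → ℤₚ x → ℤₚ (- x)
  ℤₚ-neg {x} x∈ = subst ℤₚ (neg-one x) (ℤₚ-* (ℤₚ-ℤ ℤ.-[1+ 0 ]) x∈)
    where
    neg-one : ∀ x → - 1ℚ * x ≡ - x
    neg-one = solve-∀ ℚ-ring

  ℤₚ-∏ : ∀ {f} n → (∀ i → i < n → ℤₚ (f i)) → ℤₚ (∏ f n)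
  ℤₚ-∏ zero _ = ℤₚ-1
  ℤₚ-∏ (suc n) f∈ = ℤₚ-* (ℤₚ-∏ n (λ i i<n → f∈ i (ℕP.m<n⇒m<1+n i<n))) (f∈ n ℕP.≤-refl)

  ℤₚ-∑ : ∀ {f} n → (∀ i → i < n → ℤₚ (f i)) → ℤₚ (∑ f n)
  ℤₚ-∑ zero _ = ℤₚ-0
  ℤₚ-∑ (suc n) f∈ = ℤₚ-+ (ℤₚ-∑ n (λ i i<n → f∈ i (ℕP.m<n⇒m<1+n i<n))) (f∈ n ℕP.≤-refl)

  ℤₚ-sign : ∀ n → ℤₚ (sign n)
  ℤₚ-sign n = ℤₚ-∏ n (λ _ _ → ℤₚ-neg ℤₚ-1)

  ℤₚ-falling : ∀ {c} n → ℤₚ c → ℤₚ (falling c n)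
  ℤₚ-falling zero _ = ℤₚ-1
  ℤₚ-falling (suc n) c∈ = ℤₚ-* (ℤₚ-falling n c∈) (ℤₚ-+ c∈ (ℤₚ-neg (ℤₚ-ℕ n)))

  record Unitₚ (f g : ℚ) : Set where
    field
      ℤₚ-unit : ℤₚ f
      ℤₚ-inverse : ℤₚ g
      inverse : f * g ≡ 1ℚ
  open Unitₚ public

  unit-ℕ : ∀ n → ¬ p ∣ n → Unitₚ (ℕ→ℚ n) (inv n)
  unit-ℕ zero p∤0 = ⊥-elim (p∤0 (divides 0 refl))
  unit-ℕ (suc n) p∤n = record
    { ℤₚ-unit = ℤₚ-ℕ (suc n)
    ; ℤₚ-inverse = fraction⇒ℤₚ (ℤ.+ 1) (suc n) p∤n (inv-inverseˡ n)
    ; inverse = trans (ℚP.*-comm (ℕ→ℚ (suc n)) (inv (suc n))) (inv-inverseˡ n) }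

  unit-< : ∀ n → 0 < n → n < p → Unitₚ (ℕ→ℚ n) (inv n)
  unit-< n 0<n n<p = unit-ℕ n (p∤-< 0<n n<p)

  unit-fac : ∀ n → n < p → Unitₚ (fac n) (inv (n !))
  unit-fac n n<p = unit-ℕ (n !) (p∤! n<p)

  unit-neg : ∀ {f g} → Unitₚ f g → Unitₚ (- f) (- g)
  unit-neg {f} {g} u = record
    { ℤₚ-unit = ℤₚ-neg (ℤₚ-unit u) ; ℤₚ-inverse = ℤₚ-neg (ℤₚ-inverse u)
    ; inverse = trans (neg-*-neg f g) (inverse u) }
    where
    neg-*-neg : ∀ f g → - f * - g ≡ f * g
    neg-*-neg = solve-∀ ℚ-ring

  unit-* : ∀ {f g f′ g′} → Unitₚ f g → Unitₚ f′ g′ → Unitₚ (f * f′) (g * g′)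
  unit-* {f} {g} {f′} {g′} u u′ = record
    { ℤₚ-unit = ℤₚ-* (ℤₚ-unit u) (ℤₚ-unit u′) ; ℤₚ-inverse = ℤₚ-* (ℤₚ-inverse u) (ℤₚ-inverse u′)
    ; inverse = trans (interchange f g f′ g′) (cong₂ _*_ (inverse u) (inverse u′)) }
    where
    interchange : ∀ f g f′ g′ → f * f′ * (g * g′) ≡ f * g * (f′ * g′)
    interchange = solve-∀ ℚ-ring

  ℤₚ-H : ∀ n → n < p → ℤₚ (H n)
  ℤₚ-H zero _ = ℤₚ-0
  ℤₚ-H (suc n) n<p = ℤₚ-+ (ℤₚ-H n (ℕP.<-trans (ℕP.n<1+n n) n<p)) (ℤₚ-inverse (unit-< (suc n) (ℕ.s≤s ℕ.z≤n) n<p))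

  infix 4 _≈_[p^_]
  record _≈_[p^_] (a b : ℚ) (m : ℕ) : Set where
    constructor ≈-by
    field
      quotient : ℚ
      ℤₚ-quotient : ℤₚ quotient
      difference : a - b ≡ ℕ→ℚ (p ℕ.^ m) * quotient

  ≈⇒CongMod : ∀ {a b m} → a ≈ b [p^ m ] → CongMod a b p m
  ≈⇒CongMod (≈-by z z∈ a-b) = z , denominator-coprime z∈ , a-b

  p^2 : ℕ→ℚ (p ℕ.^ 2) ≡ P * P
  p^2 = trans (ℕ→ℚ-* p (p ℕ.* 1)) (cong (P *_) (cong ℕ→ℚ (ℕP.*-identityʳ p)))

  p^3 : ℕ→ℚ (p ℕ.^ 3) ≡ P * P * P
  p^3 = trans (ℕ→ℚ-* p (p ℕ.^ 2)) (trans (cong (P *_) p^2) (sym (ℚP.*-assoc P P P)))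

  ≈-p : ∀ {a b} z → ℤₚ z → a - b ≡ P * z → a ≈ b [p^ 1 ]
  ≈-p {a} {b} z z∈ a-b = ≈-by z z∈ (trans a-b (cong (_* z) (cong ℕ→ℚ (sym (ℕP.*-identityʳ p)))))

  ≈-p² : ∀ {a b} z → ℤₚ z → a - b ≡ P * P * z → a ≈ b [p^ 2 ]
  ≈-p² {a} {b} z z∈ a-b = ≈-by z z∈ (trans a-b (cong (_* z) (sym p^2)))

  module _ {m : ℕ} where
    private
      pᵐ : ℚ
      pᵐ = ℕ→ℚ (p ℕ.^ m)
      self-diff : ∀ a c → a - a ≡ c * 0ℚ
      self-diff = solve-∀ ℚ-ring
      flip-diff : ∀ a b c z → a - b ≡ c * z → b - a ≡ c * - z
      flip-diff a b c z a-b = trans (negate a b) (trans (cong -_ a-b) (ℚP.neg-distribʳ-* c z))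
        where
        negate : ∀ a b → b - a ≡ - (a - b)
        negate = solve-∀ ℚ-ring
      chain : ∀ a b c → a - c ≡ (a - b) + (b - c)
      chain = solve-∀ ℚ-ring
      sum-diff : ∀ a b c d → (a + c) - (b + d) ≡ (a - b) + (c - d)
      sum-diff = solve-∀ ℚ-ring
      collect : ∀ c z z′ → c * z + c * z′ ≡ c * (z + z′)
      collect = solve-∀ ℚ-ring

    ≈-refl : ∀ {a} → a ≈ a [p^ m ]
    ≈-refl {a} = ≈-by 0ℚ ℤₚ-0 (self-diff a pᵐ)

    ≈-reflexive : ∀ {a b} → a ≡ b → a ≈ b [p^ m ]
    ≈-reflexive refl = ≈-refl

    ≈-sym : ∀ {a b} → a ≈ b [p^ m ] → b ≈ a [p^ m ]
    ≈-sym {a} {b} (≈-by z z∈ a-b) = ≈-by (- z) (ℤₚ-neg z∈) (flip-diff a b pᵐ z a-b)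

    ≈-trans : ∀ {a b c} → a ≈ b [p^ m ] → b ≈ c [p^ m ] → a ≈ c [p^ m ]
    ≈-trans {a} {b} {c} (≈-by z z∈ a-b) (≈-by z′ z′∈ b-c) =
      ≈-by (z + z′) (ℤₚ-+ z∈ z′∈) (trans (chain a b c) (trans (cong₂ _+_ a-b b-c) (collect pᵐ z z′)))

    ≈-setoid : Setoid 0ℓ 0ℓ
    ≈-setoid = record
      { Carrier = ℚ ; _≈_ = λ a b → a ≈ b [p^ m ]
      ; isEquivalence = record { refl = ≈-refl ; sym = ≈-sym ; trans = ≈-trans } }

    +-cong : ∀ {a b c d} → a ≈ b [p^ m ] → c ≈ d [p^ m ] → a + c ≈ b + d [p^ m ]
    +-cong {a} {b} {c} {d} (≈-by z z∈ a-b) (≈-by z′ z′∈ c-d) =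
      ≈-by (z + z′) (ℤₚ-+ z∈ z′∈) (trans (sum-diff a b c d) (trans (cong₂ _+_ a-b c-d) (collect pᵐ z z′)))

    *-congˡ : ∀ {a b} k → ℤₚ k → a ≈ b [p^ m ] → k * a ≈ k * b [p^ m ]
    *-congˡ {a} {b} k k∈ (≈-by z z∈ a-b) = ≈-by (k * z) (ℤₚ-* k∈ z∈) (begin
      k * a - k * b    ≡⟨ factor k a b ⟩
      k * (a - b)      ≡⟨ cong (k *_) a-b ⟩
      k * (pᵐ * z)     ≡⟨ swap k pᵐ z ⟩
      pᵐ * (k * z)     ∎)
      where
      open ≡-Reasoning
      factor : ∀ k a b → k * a - k * b ≡ k * (a - b)
      factor = solve-∀ ℚ-ring
      swap : ∀ k c z → k * (c * z) ≡ c * (k * z)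
      swap = solve-∀ ℚ-ring

    neg-cong : ∀ {a b} → a ≈ b [p^ m ] → - a ≈ - b [p^ m ]
    neg-cong {a} {b} a≈b = subst₂ (λ x y → x ≈ y [p^ m ]) (neg-one a) (neg-one b) (*-congˡ (- 1ℚ) (ℤₚ-neg ℤₚ-1) a≈b)
      where
      neg-one : ∀ x → - 1ℚ * x ≡ - x
      neg-one = solve-∀ ℚ-ring

    *-cong : ∀ {a b c d} → ℤₚ b → ℤₚ c → a ≈ b [p^ m ] → c ≈ d [p^ m ] → a * c ≈ b * d [p^ m ]
    *-cong {a} {b} {c} {d} b∈ c∈ a≈b c≈d = ≈-trans (subst₂ (λ x y → x ≈ y [p^ m ]) (ℚP.*-comm c a) (ℚP.*-comm c b) (*-congˡ c c∈ a≈b))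
                                                    (*-congˡ b b∈ c≈d)

    ∑-cong : ∀ {f g} n → (∀ i → i < n → f i ≈ g i [p^ m ]) → ∑ f n ≈ ∑ g n [p^ m ]
    ∑-cong zero _ = ≈-refl
    ∑-cong (suc n) f≈g = +-cong (∑-cong n (λ i i<n → f≈g i (ℕP.m<n⇒m<1+n i<n))) (f≈g n ℕP.≤-refl)

    ≈-difference : ∀ {a b} → a ≈ b [p^ m ] → a - b ≈ 0ℚ [p^ m ]
    ≈-difference {a} {b} (≈-by z z∈ a-b) = ≈-by z z∈ (trans (minus-zero (a - b)) a-b)
      where
      minus-zero : ∀ x → x - 0ℚ ≡ x
      minus-zero = solve-∀ ℚ-ring

    ℤₚ-≈ : ∀ {a b} → ℤₚ b → a ≈ b [p^ m ] → ℤₚ a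
    ℤₚ-≈ {a} {b} b∈ (≈-by z z∈ a-b) = subst ℤₚ (sym (trans (split a b) (cong (b +_) a-b))) (ℤₚ-+ b∈ (ℤₚ-* (ℤₚ-ℕ (p ℕ.^ m)) z∈))
      where
      split : ∀ a b → a ≡ b + (a - b)
      split = solve-∀ ℚ-ring

    unit-cancel : ∀ {a b f g} → Unitₚ f g → f * a ≈ f * b [p^ m ] → a ≈ b [p^ m ]
    unit-cancel {a} {b} {f} {g} u fa≈fb = subst₂ (λ x y → x ≈ y [p^ m ]) (cancel a) (cancel b) (*-congˡ g (ℤₚ-inverse u) fa≈fb)
      where
      cancel : ∀ x → g * (f * x) ≡ x
      cancel x = trans (sym (ℚP.*-assoc g f x)) (trans (cong (_* x) (trans (ℚP.*-comm g f) (inverse u))) (ℚP.*-identityˡ x))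

    -- From g - g′ = - g g′ (f - f′) when f g = f′ g′ = 1.
    inverse-cong : ∀ {f g f′ g′} → Unitₚ f g → Unitₚ f′ g′ → f ≈ f′ [p^ m ] → g ≈ g′ [p^ m ]
    inverse-cong {f} {g} {f′} {g′} u u′ (≈-by z z∈ f-f′) =
      ≈-by (- (g * g′ * z)) (ℤₚ-neg (ℤₚ-* (ℤₚ-* (ℤₚ-inverse u) (ℤₚ-inverse u′)) z∈)) (begin
        g - g′                                                         ≡⟨ expand g g′ f f′ ⟩
        - (g * g′ * (f - f′)) + (g * (1ℚ - f′ * g′) - g′ * (1ℚ - f * g)) ≡⟨ cong₂ (λ x y → - (g * g′ * (f - f′)) + (g * (1ℚ - x) - g′ * (1ℚ - y))) (inverse u′) (inverse u) ⟩
        - (g * g′ * (f - f′)) + (g * (1ℚ - 1ℚ) - g′ * (1ℚ - 1ℚ))       ≡⟨ drop g g′ (f - f′) ⟩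
        - (g * g′ * (f - f′))                                          ≡⟨ cong (λ y → - (g * g′ * y)) f-f′ ⟩
        - (g * g′ * (pᵐ * z))                                          ≡⟨ swap g g′ pᵐ z ⟩
        pᵐ * - (g * g′ * z)                                            ∎)
      where
      open ≡-Reasoning
      expand : ∀ g g′ f f′ → g - g′ ≡ - (g * g′ * (f - f′)) + (g * (1ℚ - f′ * g′) - g′ * (1ℚ - f * g))
      expand = solve-∀ ℚ-ring
      drop : ∀ g g′ x → - (g * g′ * x) + (g * (1ℚ - 1ℚ) - g′ * (1ℚ - 1ℚ)) ≡ - (g * g′ * x)
      drop = solve-∀ ℚ-ring
      swap : ∀ g g′ c z → - (g * g′ * (c * z)) ≡ c * - (g * g′ * z)
      swap = solve-∀ ℚ-ring

  ≈-weaken : ∀ {a b m} → a ≈ b [p^ suc m ] → a ≈ b [p^ m ]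
  ≈-weaken {a} {b} {m} (≈-by z z∈ a-b) = ≈-by (P * z) (ℤₚ-* (ℤₚ-ℕ p) z∈)
    (trans a-b (trans (cong (_* z) (ℕ→ℚ-* p (p ℕ.^ m))) (reassoc P (ℕ→ℚ (p ℕ.^ m)) z)))
    where
    reassoc : ∀ q c z → q * c * z ≡ c * (q * z)
    reassoc = solve-∀ ℚ-ring

  p*-cong : ∀ {a b m} → a ≈ b [p^ m ] → P * a ≈ P * b [p^ suc m ]
  p*-cong {a} {b} {m} (≈-by z z∈ a-b) = ≈-by z z∈ (begin
    P * a - P * b                   ≡⟨ factor P a b ⟩
    P * (a - b)                     ≡⟨ cong (P *_) a-b ⟩
    P * (ℕ→ℚ (p ℕ.^ m) * z)         ≡⟨ ℚP.*-assoc P _ z ⟨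
    P * ℕ→ℚ (p ℕ.^ m) * z           ≡⟨ cong (_* z) (ℕ→ℚ-* p (p ℕ.^ m)) ⟨
    ℕ→ℚ (p ℕ.^ suc m) * z           ∎)
    where
    open ≡-Reasoning
    factor : ∀ k a b → k * a - k * b ≡ k * (a - b)
    factor = solve-∀ ℚ-ring

  inv-p*p : inv p * P ≡ 1ℚ
  inv-p*p = inv-prime p p-prime
    where
    inv-prime : ∀ q → Prime q → inv q * ℕ→ℚ q ≡ 1ℚ
    inv-prime zero    0-prime = ⊥-elim (¬prime[0] 0-prime)
    inv-prime (suc n) _       = inv-inverseˡ n

  p*-cancel : ∀ {a b m} → P * a ≈ P * b [p^ suc m ] → a ≈ b [p^ m ]
  p*-cancel {a} {b} {m} (≈-by z z∈ pa-pb) = ≈-by z z∈ (begin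
    a - b                                   ≡⟨ ℚP.*-identityˡ (a - b) ⟨
    1ℚ * (a - b)                            ≡⟨ cong (_* (a - b)) inv-p*p ⟨
    inv p * P * (a - b)                     ≡⟨ factor (inv p) P a b ⟩
    inv p * (P * a - P * b)                 ≡⟨ cong (inv p *_) pa-pb ⟩
    inv p * (ℕ→ℚ (p ℕ.^ suc m) * z)         ≡⟨ cong (λ y → inv p * (y * z)) (ℕ→ℚ-* p (p ℕ.^ m)) ⟩
    inv p * (P * ℕ→ℚ (p ℕ.^ m) * z)         ≡⟨ reassoc (inv p) P (ℕ→ℚ (p ℕ.^ m)) z ⟩
    inv p * P * (ℕ→ℚ (p ℕ.^ m) * z)         ≡⟨ cong (_* (ℕ→ℚ (p ℕ.^ m) * z)) inv-p*p ⟩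
    1ℚ * (ℕ→ℚ (p ℕ.^ m) * z)                ≡⟨ ℚP.*-identityˡ _ ⟩
    ℕ→ℚ (p ℕ.^ m) * z                       ∎)
    where
    open ≡-Reasoning
    factor : ∀ i q a b → i * q * (a - b) ≡ i * (q * a - q * b)
    factor = solve-∀ ℚ-ring
    reassoc : ∀ i q c z → i * (q * c * z) ≡ i * q * (c * z)
    reassoc = solve-∀ ℚ-ring

  -- First-order expansions of products

  expansion-* : ∀ {a a′ b b′ s s′ w} → ℤₚ w → ℤₚ b → ℤₚ b′ → ℤₚ s → ℤₚ s′ →
    a ≈ b * (1ℚ + P * w * s) [p^ 2 ] → a′ ≈ b′ * (1ℚ + P * w * s′) [p^ 2 ] →
    a * a′ ≈ b * b′ * (1ℚ + P * w * (s + s′)) [p^ 2 ]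
  expansion-* {a} {a′} {b} {b′} {s} {s′} {w} w∈ b∈ b′∈ s∈ s′∈ a≈ a′≈ =
    ≈-trans (*-cong first∈ (ℤₚ-≈ second∈ a′≈) a≈ a′≈)
            (≈-p² (b * b′ * w * w * s * s′) (ℤₚ-* (ℤₚ-* (ℤₚ-* (ℤₚ-* (ℤₚ-* b∈ b′∈) w∈) w∈) s∈) s′∈) (cross-term b b′ P w s s′))
    where
    first∈ : ℤₚ (b * (1ℚ + P * w * s))
    first∈ = ℤₚ-* b∈ (ℤₚ-+ ℤₚ-1 (ℤₚ-* (ℤₚ-* (ℤₚ-ℕ p) w∈) s∈))
    second∈ : ℤₚ (b′ * (1ℚ + P * w * s′))
    second∈ = ℤₚ-* b′∈ (ℤₚ-+ ℤₚ-1 (ℤₚ-* (ℤₚ-* (ℤₚ-ℕ p) w∈) s′∈))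
    cross-term : ∀ b b′ q w s s′ →
      b * (1ℚ + q * w * s) * (b′ * (1ℚ + q * w * s′)) - b * b′ * (1ℚ + q * w * (s + s′)) ≡ q * q * (b * b′ * w * w * s * s′)
    cross-term = solve-∀ ℚ-ring

  ∏-expansion : ∀ {w} f g n → ℤₚ w → (∀ i → i < n → Unitₚ (f i) (g i)) →
    ∏ (λ i → f i + P * w) n ≈ ∏ f n * (1ℚ + P * w * ∑ g n) [p^ 2 ]
  ∏-expansion {w} f g zero w∈ _ = ≈-reflexive (empty (P * w))
    where
    empty : ∀ x → 1ℚ ≡ 1ℚ * (1ℚ + x * 0ℚ)
    empty = solve-∀ ℚ-ring
  ∏-expansion {w} f g (suc n) w∈ units =
    expansion-* w∈ (ℤₚ-∏ n (λ i i<n → ℤₚ-unit (units′ i i<n))) (ℤₚ-unit last) (ℤₚ-∑ n (λ i i<n → ℤₚ-inverse (units′ i i<n)))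
                (ℤₚ-inverse last) (∏-expansion f g n w∈ units′) (≈-reflexive exact)
    where
    units′ : ∀ i → i < n → Unitₚ (f i) (g i)
    units′ i i<n = units i (ℕP.m<n⇒m<1+n i<n)
    last : Unitₚ (f n) (g n)
    last = units n ℕP.≤-refl
    factor-out : ∀ f g x → f + x ≡ f * (1ℚ + x * g) + x * (1ℚ - f * g)
    factor-out = solve-∀ ℚ-ring
    drop : ∀ a x → a + x * (1ℚ - 1ℚ) ≡ a
    drop = solve-∀ ℚ-ring
    exact : f n + P * w ≡ f n * (1ℚ + P * w * g n)
    exact = trans (factor-out (f n) (g n) (P * w))
                  (trans (cong (λ y → f n * (1ℚ + P * w * g n) + P * w * (1ℚ - y)) (inverse last)) (drop _ (P * w)))

  falling-expansion : ∀ {w} c g n → ℤₚ w → (∀ i → i < n → Unitₚ (c - ℕ→ℚ i) (g i)) →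
    falling (c + P * w) n ≈ falling c n * (1ℚ + P * w * ∑ g n) [p^ 2 ]
  falling-expansion {w} c g n w∈ units =
    subst₂ (λ x y → x ≈ y * (1ℚ + P * w * ∑ g n) [p^ 2 ])
      (trans (∏-cong n (λ i _ → swap c (P * w) (ℕ→ℚ i))) (sym (falling≡∏ (c + P * w) n)))
      (sym (falling≡∏ c n))
      (∏-expansion (λ i → c - ℕ→ℚ i) g n w∈ units)
    where
    swap : ∀ c x i → c - i + x ≡ c + x - i
    swap = solve-∀ ℚ-ring

  falling-ℕ-expansion : ∀ {w} a → a < p → ℤₚ w → falling (ℕ→ℚ a + P * w) a ≈ fac a * (1ℚ + P * w * H a) [p^ 2 ]
  falling-ℕ-expansion {w} a a<p w∈ =
    subst₂ (λ x y → falling (ℕ→ℚ a + P * w) a ≈ x * (1ℚ + P * w * y) [p^ 2 ])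
      (falling-ℕ a) (trans (∑-inv-∸ 0 a) (ℚP.+-identityʳ (H a)))
      (falling-expansion (ℕ→ℚ a) (λ i → inv (a ℕ.∸ i)) a w∈ unit)
    where
    unit : ∀ i → i < a → Unitₚ (ℕ→ℚ a - ℕ→ℚ i) (inv (a ℕ.∸ i))
    unit i i<a = subst (λ x → Unitₚ x (inv (a ℕ.∸ i))) (ℕ→ℚ-∸ (ℕP.<⇒≤ i<a))
                   (unit-< (a ℕ.∸ i) (ℕP.m<n⇒0<n∸m i<a) (ℕP.≤-<-trans (ℕP.m∸n≤m a i) a<p))

  falling-neg-expansion : ∀ {w} b n → b ℕ.+ n < p → ℤₚ w →
    falling (- ℕ→ℚ (suc b) + P * w) n ≈ falling (- ℕ→ℚ (suc b)) n * (1ℚ + P * w * (H b - H (b ℕ.+ n))) [p^ 2 ]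
  falling-neg-expansion {w} b n b+n<p w∈ =
    subst (λ y → falling (- ℕ→ℚ (suc b) + P * w) n ≈ falling (- ℕ→ℚ (suc b)) n * (1ℚ + P * w * y) [p^ 2 ])
      (∑-neg-inv b n)
      (falling-expansion (- ℕ→ℚ (suc b)) (λ i → - inv (suc (b ℕ.+ i))) n w∈ unit)
    where
    neg-sum : ∀ b i → - (b + 1ℚ) - i ≡ - (b + i + 1ℚ)
    neg-sum = solve-∀ ℚ-ring
    shift : ∀ i → - ℕ→ℚ (suc (b ℕ.+ i)) ≡ - ℕ→ℚ (suc b) - ℕ→ℚ i
    shift i = begin
      - ℕ→ℚ (suc (b ℕ.+ i))         ≡⟨ cong -_ (trans (ℕ→ℚ-suc (b ℕ.+ i)) (cong (_+ 1ℚ) (ℕ→ℚ-+ b i))) ⟩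
      - (ℕ→ℚ b + ℕ→ℚ i + 1ℚ)        ≡⟨ neg-sum (ℕ→ℚ b) (ℕ→ℚ i) ⟨
      - (ℕ→ℚ b + 1ℚ) - ℕ→ℚ i        ≡⟨ cong (λ y → - y - ℕ→ℚ i) (ℕ→ℚ-suc b) ⟨
      - ℕ→ℚ (suc b) - ℕ→ℚ i         ∎
      where open ≡-Reasoning
    unit : ∀ i → i < n → Unitₚ (- ℕ→ℚ (suc b) - ℕ→ℚ i) (- inv (suc (b ℕ.+ i)))
    unit i i<n = subst (λ x → Unitₚ x (- inv (suc (b ℕ.+ i)))) (shift i)
                   (unit-neg (unit-< (suc (b ℕ.+ i)) (ℕ.s≤s ℕ.z≤n) (ℕP.≤-<-trans (subst (_≤ b ℕ.+ n) (ℕP.+-suc b i) (ℕP.+-monoʳ-≤ b i<n)) b+n<p)))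

  ≈-inverse-expansion : ∀ {R r⁻¹ U a c} → Unitₚ R r⁻¹ → ℤₚ U → ℤₚ a → ℤₚ c →
    R * U * (1ℚ - P * a) ≈ 1ℚ + P * c [p^ 2 ] → U ≈ r⁻¹ * (1ℚ + P * (c + a)) [p^ 2 ]
  ≈-inverse-expansion {R} {r⁻¹} {U} {a} {c} unit U∈ a∈ c∈ RU≈ = begin
    U                                              ≈⟨ ≈-p² (U * a * a) (ℤₚ-* (ℤₚ-* U∈ a∈) a∈) multiply-out ⟩
    r⁻¹ * (1ℚ + P * a) * (R * U * (1ℚ - P * a))    ≈⟨ *-congˡ (r⁻¹ * (1ℚ + P * a)) (ℤₚ-* (ℤₚ-inverse unit) (ℤₚ-+ ℤₚ-1 (ℤₚ-* (ℤₚ-ℕ p) a∈))) RU≈ ⟩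
    r⁻¹ * (1ℚ + P * a) * (1ℚ + P * c)              ≈⟨ ≈-p² (r⁻¹ * a * c) (ℤₚ-* (ℤₚ-* (ℤₚ-inverse unit) a∈) c∈) (cross-term r⁻¹ P a c) ⟩
    r⁻¹ * (1ℚ + P * (c + a))                       ∎
    where
    open import Relation.Binary.Reasoning.Setoid (≈-setoid {2})
    expand : ∀ U i R q a → U - i * (1ℚ + q * a) * (R * U * (1ℚ - q * a)) ≡ U * (1ℚ - R * i) + q * q * (U * a * a * (R * i))
    expand = solve-∀ ℚ-ring
    simplify : ∀ U q a → U * (1ℚ - 1ℚ) + q * q * (U * a * a * 1ℚ) ≡ q * q * (U * a * a)
    simplify = solve-∀ ℚ-ring
    multiply-out : U - r⁻¹ * (1ℚ + P * a) * (R * U * (1ℚ - P * a)) ≡ P * P * (U * a * a)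
    multiply-out = trans (expand U r⁻¹ R P a)
      (trans (cong (λ y → U * (1ℚ - y) + P * P * (U * a * a * y)) (inverse unit)) (simplify U P a))
    cross-term : ∀ i q a c → i * (1ℚ + q * a) * (1ℚ + q * c) - i * (1ℚ + q * (c + a)) ≡ q * q * (i * a * c)
    cross-term = solve-∀ ℚ-ring

  -- With u = 1/S, v = 1/R and R + S = p one has u + v = p u v, which kills the terms of order p and p².
  reflection-rhs : ∀ {R S u v} t c → ℤₚ t → ℤₚ c → Unitₚ S u → Unitₚ R v → R + S ≡ P →
    P * - (t + 1ℚ) * u + P * P * - (t + 1ℚ) * u * c - P * P * - (t + 1ℚ) * - (t + 1ℚ) * u * u
      ≈ P * (t + 1ℚ) * v + P * P * (t + 1ℚ) * v * c - P * P * t * (t + 1ℚ) * v * v [p^ 3 ]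
  reflection-rhs {R} {S} {u} {v} t c t∈ c∈ unit-S unit-R R+S≡P = ≈-by z z∈ (begin
    lhs - rhs                                   ≡⟨ expand P t u v c ⟩
    (u + v - P * u * v) * k + P * P * P * z      ≡⟨ cong (λ y → y * k + P * P * P * z) u+v≡puv ⟩
    0ℚ * k + P * P * P * z                       ≡⟨ drop k (P * P * P * z) ⟩
    P * P * P * z                                ≡⟨ cong (_* z) p^3 ⟨
    ℕ→ℚ (p ℕ.^ 3) * z                            ∎)
    where
    open ≡-Reasoning
    T lhs rhs k z : ℚ
    T = t + 1ℚ
    lhs = P * - T * u + P * P * - T * u * c - P * P * - T * - T * u * u
    rhs = P * T * v + P * P * T * v * c - P * P * t * T * v * v
    k = - (P * T) - P * P * T * c + P * P * T * T * (v - u) - P * P * T * v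
    z = T * (- (u * v * v) + T * (v - u) * u * v - c * u * v)
    z∈ : ℤₚ z
    z∈ = ℤₚ-* T∈ (ℤₚ-+ (ℤₚ-+ (ℤₚ-neg (ℤₚ-* (ℤₚ-* u∈ v∈) v∈)) (ℤₚ-* (ℤₚ-* (ℤₚ-* T∈ (ℤₚ-+ v∈ (ℤₚ-neg u∈))) u∈) v∈))
                        (ℤₚ-neg (ℤₚ-* (ℤₚ-* c∈ u∈) v∈)))
      where
      T∈ : ℤₚ T
      T∈ = ℤₚ-+ t∈ ℤₚ-1
      u∈ : ℤₚ u
      u∈ = ℤₚ-inverse unit-S
      v∈ : ℤₚ v
      v∈ = ℤₚ-inverse unit-R
    expand : ∀ q t u v c →
      q * - (t + 1ℚ) * u + q * q * - (t + 1ℚ) * u * c - q * q * - (t + 1ℚ) * - (t + 1ℚ) * u * u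
        - (q * (t + 1ℚ) * v + q * q * (t + 1ℚ) * v * c - q * q * t * (t + 1ℚ) * v * v)
      ≡ (u + v - q * u * v) * (- (q * (t + 1ℚ)) - q * q * (t + 1ℚ) * c + q * q * (t + 1ℚ) * (t + 1ℚ) * (v - u) - q * q * (t + 1ℚ) * v)
        + q * q * q * ((t + 1ℚ) * (- (u * v * v) + (t + 1ℚ) * (v - u) * u * v - c * u * v))
    expand = solve-∀ ℚ-ring
    drop : ∀ k y → 0ℚ * k + y ≡ y
    drop = solve-∀ ℚ-ring
    split : ∀ u v R S → u + v - (R + S) * u * v ≡ u * (1ℚ - R * v) + v * (1ℚ - S * u)
    split = solve-∀ ℚ-ring
    vanish : ∀ u v → u * (1ℚ - 1ℚ) + v * (1ℚ - 1ℚ) ≡ 0ℚ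
    vanish = solve-∀ ℚ-ring
    u+v≡puv : u + v - P * u * v ≡ 0ℚ
    u+v≡puv = trans (cong (λ y → u + v - y * u * v) (sym R+S≡P))
                (trans (split u v R S) (trans (cong₂ (λ x y → u * (1ℚ - x) + v * (1ℚ - y)) (inverse unit-R) (inverse unit-S)) (vanish u v)))

  -- Wilson-type congruences, harmonic numbers and the Fermat quotient

  module OddPrime (h : ℕ) (p≡2h+1 : p ≡ suc (h ℕ.+ h)) where

    h+h<p : h ℕ.+ h < p
    h+h<p = subst (h ℕ.+ h <_) (sym p≡2h+1) ℕP.≤-refl

    h<p : h < p
    h<p = ℕP.≤-<-trans (ℕP.m≤m+n h h) h+h<p

    P≡2h+1 : P ≡ ℕ→ℚ (h ℕ.+ h) + 1ℚ
    P≡2h+1 = trans (cong ℕ→ℚ p≡2h+1) (ℕ→ℚ-suc (h ℕ.+ h))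

    sign-h+h : sign (h ℕ.+ h) ≡ 1ℚ
    sign-h+h = trans (sign-+ h h) (sign-sq h)

    wilson-expansion : ∀ m → m ≤ h ℕ.+ h → falling (ℕ→ℚ (h ℕ.+ h)) m ≈ sign m * fac m * (1ℚ - P * H m) [p^ 2 ]
    wilson-expansion m m≤2h = subst₂ (λ x y → falling x m ≈ y [p^ 2 ]) base expansion
      (falling-neg-expansion 0 m (ℕP.≤-<-trans m≤2h h+h<p) ℤₚ-1)
      where
      minus-one : ∀ t → - 1ℚ + (t + 1ℚ) * 1ℚ ≡ t
      minus-one = solve-∀ ℚ-ring
      tidy : ∀ q x → 1ℚ + q * 1ℚ * (0ℚ - x) ≡ 1ℚ - q * x
      tidy = solve-∀ ℚ-ring
      base : - 1ℚ + P * 1ℚ ≡ ℕ→ℚ (h ℕ.+ h)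
      base = trans (cong (λ y → - 1ℚ + y * 1ℚ) P≡2h+1) (minus-one (ℕ→ℚ (h ℕ.+ h)))
      expansion : falling (- 1ℚ) m * (1ℚ + P * 1ℚ * (0ℚ - H m)) ≡ sign m * fac m * (1ℚ - P * H m)
      expansion = cong₂ _*_ (falling-minus-one m) (tidy P (H m))

    H[p-1]≈0 : H (h ℕ.+ h) ≈ 0ℚ [p^ 1 ]
    H[p-1]≈0 = p*-cancel (unit-cancel (unit-fac (h ℕ.+ h) h+h<p)
      (subst₂ (λ x y → x ≈ y [p^ 2 ]) (factor-out F (P * H (h ℕ.+ h))) (annihilate F P) (≈-difference wilson)))
      where
      F : ℚ
      F = fac (h ℕ.+ h)
      factor-out : ∀ f x → f - f * (1ℚ - x) ≡ f * x
      factor-out = solve-∀ ℚ-ring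
      annihilate : ∀ f q → 0ℚ ≡ f * (q * 0ℚ)
      annihilate = solve-∀ ℚ-ring
      wilson : F ≈ F * (1ℚ - P * H (h ℕ.+ h)) [p^ 2 ]
      wilson = subst₂ (λ x y → x ≈ y * (1ℚ - P * H (h ℕ.+ h)) [p^ 2 ])
        (falling-ℕ (h ℕ.+ h)) (trans (cong (_* F) sign-h+h) (ℚP.*-identityˡ F))
        (wilson-expansion (h ℕ.+ h) ℕP.≤-refl)

    -- Termwise 1/(p-1-i) ≡ -1/(i+1) (mod p).
    H-reflect : ∀ a b → a ℕ.+ b ≡ h ℕ.+ h → H a ≈ H b [p^ 1 ]
    H-reflect a b a+b≡2h = subst₂ (λ x y → x ≈ y [p^ 1 ]) (recover (H (a ℕ.+ b)) (H a)) (recover 0ℚ (H b))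
      (+-cong H[a+b]≈0 (neg-cong tail))
      where
      recover : ∀ x y → x + - (x - y) ≡ y
      recover = solve-∀ ℚ-ring
      H[a+b]≈0 : H (a ℕ.+ b) ≈ 0ℚ [p^ 1 ]
      H[a+b]≈0 = subst (λ k → H k ≈ 0ℚ [p^ 1 ]) (sym a+b≡2h) H[p-1]≈0
      complement : ∀ i → i < b → ℕ→ℚ ((a ℕ.+ b) ℕ.∸ i) - - ℕ→ℚ (suc i) ≡ P * 1ℚ
      complement i i<b = begin
        ℕ→ℚ ((a ℕ.+ b) ℕ.∸ i) - - ℕ→ℚ (suc i)     ≡⟨ minus-neg (ℕ→ℚ ((a ℕ.+ b) ℕ.∸ i)) (ℕ→ℚ (suc i)) ⟩
        ℕ→ℚ ((a ℕ.+ b) ℕ.∸ i) + ℕ→ℚ (suc i)       ≡⟨ ℕ→ℚ-+ ((a ℕ.+ b) ℕ.∸ i) (suc i) ⟨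
        ℕ→ℚ ((a ℕ.+ b) ℕ.∸ i ℕ.+ suc i)           ≡⟨ cong ℕ→ℚ sum ⟩
        P                                          ≡⟨ ℚP.*-identityʳ P ⟨
        P * 1ℚ                                     ∎
        where
        open ≡-Reasoning
        minus-neg : ∀ x y → x - - y ≡ x + y
        minus-neg = solve-∀ ℚ-ring
        i≤a+b : i ≤ a ℕ.+ b
        i≤a+b = ℕP.≤-trans (ℕP.<⇒≤ i<b) (ℕP.m≤n+m b a)
        sum : (a ℕ.+ b) ℕ.∸ i ℕ.+ suc i ≡ p
        sum = trans (ℕP.+-suc _ i) (trans (cong suc (ℕP.m∸n+n≡m i≤a+b)) (trans (cong suc a+b≡2h) (sym p≡2h+1)))
      term : ∀ i → i < b → inv ((a ℕ.+ b) ℕ.∸ i) ≈ - inv (suc i) [p^ 1 ]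
      term i i<b = inverse-cong
        (unit-< ((a ℕ.+ b) ℕ.∸ i) (ℕP.m<n⇒0<n∸m (ℕP.<-≤-trans i<b (ℕP.m≤n+m b a)))
                (ℕP.≤-<-trans (ℕP.m∸n≤m (a ℕ.+ b) i) (subst (_< p) (sym a+b≡2h) h+h<p)))
        (unit-neg (unit-< (suc i) (ℕ.s≤s ℕ.z≤n) (ℕP.≤-<-trans i<b (ℕP.≤-<-trans (ℕP.m≤n+m b a) (subst (_< p) (sym a+b≡2h) h+h<p)))))
        (≈-p 1ℚ ℤₚ-1 (complement i i<b))
      tail : H (a ℕ.+ b) - H a ≈ 0ℚ - H b [p^ 1 ]
      tail = subst₂ (λ x y → x ≈ y [p^ 1 ]) (∑-inv-∸ a b) (∑-neg-inv 0 b) (∑-cong b term)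

    wilson-half : sign h * fac (h ℕ.+ h) ≈ fac h * fac h * (1ℚ - P * H h) [p^ 2 ]
    wilson-half = subst₂ (λ x y → x ≈ y [p^ 2 ]) lhs rhs
      (*-congˡ (sign h * fac h) (ℤₚ-* (ℤₚ-sign h) (ℤₚ-ℕ (h !))) (wilson-expansion h (ℕP.m≤m+n h h)))
      where
      regroup₁ : ∀ s f x → s * f * x ≡ s * (x * f)
      regroup₁ = solve-∀ ℚ-ring
      regroup₂ : ∀ s f y → s * f * (s * f * y) ≡ s * s * (f * f * y)
      regroup₂ = solve-∀ ℚ-ring
      lhs : sign h * fac h * falling (ℕ→ℚ (h ℕ.+ h)) h ≡ sign h * fac (h ℕ.+ h)
      lhs = trans (regroup₁ (sign h) (fac h) _) (cong (sign h *_) (falling-ℕ-+ h h))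
      rhs : sign h * fac h * (sign h * fac h * (1ℚ - P * H h)) ≡ fac h * fac h * (1ℚ - P * H h)
      rhs = trans (regroup₂ (sign h) (fac h) _) (trans (cong (_* (fac h * fac h * (1ℚ - P * H h))) (sign-sq h)) (ℚP.*-identityˡ _))

    2<p : 2 < p
    2<p = bound h p≡2h+1
      where
      bound : ∀ k → p ≡ suc (k ℕ.+ k) → 2 < p
      bound zero p≡1 = ⊥-elim (¬prime[1] (subst Prime p≡1 p-prime))
      bound (suc k) p≡ = subst (2 <_) (sym p≡) (ℕ.s≤s (ℕ.s≤s (ℕP.≤-trans (ℕ.s≤s ℕ.z≤n) (ℕP.m≤n+m (suc k) k))))

    private
      double : ∀ h → 2 ℕ.* suc h ≡ suc (suc (h ℕ.+ h))
      double = ℕ-Solver.solve-∀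

    below-half : ∀ {r} → 2 ℕ.* r < p → r ≤ h
    below-half {r} 2r<p = ℕP.≤-pred (ℕP.*-cancelˡ-< 2 r (suc h)
      (ℕP.<-≤-trans 2r<p (subst (p ℕ.≤_) (sym (double h)) (ℕP.≤-trans (ℕP.≤-reflexive p≡2h+1) (ℕP.n≤1+n _)))))

    above-half : ∀ {r} → p < 2 ℕ.* r → suc h ≤ r
    above-half {r} p<2r = ℕP.*-cancelˡ-≤ 2 (subst (ℕ._≤ 2 ℕ.* r) (sym (trans (double h) (cong suc (sym p≡2h+1)))) p<2r)

    [p+1]/2≡h+1 : (p ℕ.+ 1) ℕ./ 2 ≡ suc h
    [p+1]/2≡h+1 = trans (cong (λ n → (n ℕ.+ 1) ℕ./ 2) p≡2h+1)
      (trans (cong (ℕ._/ 2) (trans (ℕP.+-comm (suc (h ℕ.+ h)) 1) (sym (trans (ℕP.*-comm (suc h) 2) (double h)))))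
             (m*n/n≡m (suc h) 2))

    unit-2 : Unitₚ (ℕ→ℚ 2) (inv 2)
    unit-2 = unit-< 2 (ℕ.s≤s ℕ.z≤n) 2<p

    -- 2i + 1 = p - 2(h - i), so the odd numbers below p expand around -2(h - i).
    odd-product-expansion :
      ∏ (λ i → ℕ→ℚ (suc (2 ℕ.* i))) h ≈ sign h * (ℕ→ℚ (2 ℕ.^ h) * fac h) * (1ℚ - P * (inv 2 * H h)) [p^ 2 ]
    odd-product-expansion = subst₂ (λ x y → x ≈ y [p^ 2 ]) (∏-cong h (λ i _ → odd i))
      (cong₂ (λ x y → x * y) ∏f (trans (cong (λ y → 1ℚ + P * 1ℚ * y) ∑g) (tidy P (inv 2 * H h))))
      (∏-expansion f g h ℤₚ-1 units)
      where
      f g : ℕ → ℚ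
      f i = - 1ℚ * (ℕ→ℚ 2 * (ℕ→ℚ h - ℕ→ℚ i))
      g i = - 1ℚ * (inv 2 * inv (h ℕ.∸ i))
      tidy : ∀ q x → 1ℚ + q * 1ℚ * (- 1ℚ * x) ≡ 1ℚ - q * x
      tidy = solve-∀ ℚ-ring
      odd-from-p : ∀ h i → - 1ℚ * ((1ℚ + 1ℚ) * (h - i)) + (h + h + 1ℚ) * 1ℚ ≡ (1ℚ + 1ℚ) * i + 1ℚ
      odd-from-p = solve-∀ ℚ-ring
      two : ℕ→ℚ 2 ≡ 1ℚ + 1ℚ
      two = ℕ→ℚ-suc 1
      odd : ∀ i → f i + P * 1ℚ ≡ ℕ→ℚ (suc (2 ℕ.* i))
      odd i = begin
        f i + P * 1ℚ                                                      ≡⟨ cong₂ (λ t q → - 1ℚ * (t * (ℕ→ℚ h - ℕ→ℚ i)) + q * 1ℚ) two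
                                                                               (trans P≡2h+1 (cong (_+ 1ℚ) (ℕ→ℚ-+ h h))) ⟩
        - 1ℚ * ((1ℚ + 1ℚ) * (ℕ→ℚ h - ℕ→ℚ i)) + (ℕ→ℚ h + ℕ→ℚ h + 1ℚ) * 1ℚ ≡⟨ odd-from-p (ℕ→ℚ h) (ℕ→ℚ i) ⟩
        (1ℚ + 1ℚ) * ℕ→ℚ i + 1ℚ                                             ≡⟨ cong (λ t → t * ℕ→ℚ i + 1ℚ) two ⟨
        ℕ→ℚ 2 * ℕ→ℚ i + 1ℚ                                                 ≡⟨ cong (_+ 1ℚ) (ℕ→ℚ-* 2 i) ⟨
        ℕ→ℚ (2 ℕ.* i) + 1ℚ                                                 ≡⟨ ℕ→ℚ-suc (2 ℕ.* i) ⟨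
        ℕ→ℚ (suc (2 ℕ.* i))                                                ∎
        where open ≡-Reasoning
      units : ∀ i → i < h → Unitₚ (f i) (g i)
      units i i<h = unit-* (unit-neg (unit-< 1 (ℕ.s≤s ℕ.z≤n) (ℕP.<-trans (ℕP.n<1+n 1) 2<p)))
        (unit-* unit-2 (subst (λ x → Unitₚ x (inv (h ℕ.∸ i))) (ℕ→ℚ-∸ (ℕP.<⇒≤ i<h))
          (unit-< (h ℕ.∸ i) (ℕP.m<n⇒0<n∸m i<h) (ℕP.≤-<-trans (ℕP.m∸n≤m h i) h<p))))
      ∏f : ∏ f h ≡ sign h * (ℕ→ℚ (2 ℕ.^ h) * fac h)
      ∏f = begin
        ∏ f h                                                       ≡⟨ ∏-* (λ _ → - 1ℚ) (λ i → ℕ→ℚ 2 * (ℕ→ℚ h - ℕ→ℚ i)) h ⟩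
        sign h * ∏ (λ i → ℕ→ℚ 2 * (ℕ→ℚ h - ℕ→ℚ i)) h              ≡⟨ cong (sign h *_) (∏-* (λ _ → ℕ→ℚ 2) (λ i → ℕ→ℚ h - ℕ→ℚ i) h) ⟩
        sign h * (∏ (λ _ → ℕ→ℚ 2) h * ∏ (λ i → ℕ→ℚ h - ℕ→ℚ i) h)   ≡⟨ cong₂ (λ x y → sign h * (x * y)) (∏-const 2 h) (sym (falling≡∏ (ℕ→ℚ h) h)) ⟩
        sign h * (ℕ→ℚ (2 ℕ.^ h) * falling (ℕ→ℚ h) h)               ≡⟨ cong (λ y → sign h * (ℕ→ℚ (2 ℕ.^ h) * y)) (falling-ℕ h) ⟩
        sign h * (ℕ→ℚ (2 ℕ.^ h) * fac h)                           ∎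
        where open ≡-Reasoning
      ∑g : ∑ g h ≡ - 1ℚ * (inv 2 * H h)
      ∑g = begin
        ∑ g h                                        ≡⟨ ∑-*ˡ (- 1ℚ) (λ i → inv 2 * inv (h ℕ.∸ i)) h ⟩
        - 1ℚ * ∑ (λ i → inv 2 * inv (h ℕ.∸ i)) h      ≡⟨ cong (- 1ℚ *_) (∑-*ˡ (inv 2) (λ i → inv (h ℕ.∸ i)) h) ⟩
        - 1ℚ * (inv 2 * ∑ (λ i → inv (h ℕ.∸ i)) h)    ≡⟨ cong (λ y → - 1ℚ * (inv 2 * y)) (trans (∑-inv-∸ 0 h) (ℚP.+-identityʳ (H h))) ⟩
        - 1ℚ * (inv 2 * H h)                         ∎
        where open ≡-Reasoning

    double-factorial : sign h * fac (h ℕ.+ h) ≡ sign h * ℕ→ℚ (2 ℕ.^ h) * fac h * ∏ (λ i → ℕ→ℚ (suc (2 ℕ.* i))) h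
    double-factorial = begin
      sign h * ℕ→ℚ ((h ℕ.+ h) !)                                          ≡⟨ cong (λ k → sign h * ℕ→ℚ k) (!-double h) ⟩
      sign h * ℕ→ℚ (2 ℕ.^ h ℕ.* h ! ℕ.* odd-product h)                    ≡⟨ cong (sign h *_) (ℕ→ℚ-* (2 ℕ.^ h ℕ.* h !) (odd-product h)) ⟩
      sign h * (ℕ→ℚ (2 ℕ.^ h ℕ.* h !) * ℕ→ℚ (odd-product h))              ≡⟨ cong₂ (λ x y → sign h * (x * y)) (ℕ→ℚ-* (2 ℕ.^ h) (h !)) (ℕ→ℚ-odd-product h) ⟩
      sign h * (ℕ→ℚ (2 ℕ.^ h) * fac h * ∏ (λ i → ℕ→ℚ (suc (2 ℕ.* i))) h) ≡⟨ regroup (sign h) _ _ _ ⟩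
      sign h * ℕ→ℚ (2 ℕ.^ h) * fac h * ∏ (λ i → ℕ→ℚ (suc (2 ℕ.* i))) h   ∎
      where
      open ≡-Reasoning
      regroup : ∀ s t f y → s * (t * f * y) ≡ s * t * f * y
      regroup = solve-∀ ℚ-ring

    -- Two expansions of (p-1)!: Wilson's, and (p-1)! = 2^h h! (1 3 5 ... (p-2)).
    four^h-relation : ℕ→ℚ (2 ℕ.^ h) * ℕ→ℚ (2 ℕ.^ h) * (1ℚ - P * (inv 2 * H h)) ≈ 1ℚ - P * H h [p^ 2 ]
    four^h-relation = unit-cancel (unit-* (unit-fac h h<p) (unit-fac h h<p)) (begin
      fac h * fac h * (E * (1ℚ - P * x))                                     ≡⟨ ℚP.*-identityˡ _ ⟨
      1ℚ * (fac h * fac h * (E * (1ℚ - P * x)))                              ≡⟨ cong (_* (fac h * fac h * (E * (1ℚ - P * x)))) (sign-sq h) ⟨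
      sign h * sign h * (fac h * fac h * (E * (1ℚ - P * x)))                 ≡⟨ squares (sign h) (ℕ→ℚ (2 ℕ.^ h)) (fac h) (1ℚ - P * x) ⟨
      sign h * ℕ→ℚ (2 ℕ.^ h) * fac h * (sign h * (ℕ→ℚ (2 ℕ.^ h) * fac h) * (1ℚ - P * x))
                                                                             ≈⟨ *-congˡ (sign h * ℕ→ℚ (2 ℕ.^ h) * fac h)
                                                                                  (ℤₚ-* (ℤₚ-* (ℤₚ-sign h) (ℤₚ-ℕ (2 ℕ.^ h))) (ℤₚ-ℕ (h !)))
                                                                                  odd-product-expansion ⟨
      sign h * ℕ→ℚ (2 ℕ.^ h) * fac h * ∏ (λ i → ℕ→ℚ (suc (2 ℕ.* i))) h      ≡⟨ double-factorial ⟨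
      sign h * fac (h ℕ.+ h)                                                 ≈⟨ wilson-half ⟩
      fac h * fac h * (1ℚ - P * H h)                                         ∎)
      where
      open import Relation.Binary.Reasoning.Setoid (≈-setoid {2})
      x : ℚ
      x = inv 2 * H h
      E : ℚ
      E = ℕ→ℚ (2 ℕ.^ h) * ℕ→ℚ (2 ℕ.^ h)
      squares : ∀ s t f y → s * t * f * (s * (t * f) * y) ≡ s * s * (f * f * (t * t * y))
      squares = solve-∀ ℚ-ring

    four^h-expansion : ℕ→ℚ (2 ℕ.^ h) * ℕ→ℚ (2 ℕ.^ h) ≈ 1ℚ - P * (inv 2 * H h) [p^ 2 ]
    four^h-expansion = begin
      E                                  ≈⟨ ≈-p² (E * x * x) (ℤₚ-* (ℤₚ-* E∈ x∈) x∈) (invert E P x) ⟩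
      (1ℚ + P * x) * (E * (1ℚ - P * x))  ≈⟨ *-congˡ (1ℚ + P * x) (ℤₚ-+ ℤₚ-1 (ℤₚ-* (ℤₚ-ℕ p) x∈)) four^h-relation ⟩
      (1ℚ + P * x) * (1ℚ - P * H h)      ≈⟨ ≈-p² (- ((1ℚ + 1ℚ) * x * x)) (ℤₚ-neg (ℤₚ-* (ℤₚ-* (ℤₚ-ℕ 2) x∈) x∈)) correction ⟩
      1ℚ - P * x                         ∎
      where
      open import Relation.Binary.Reasoning.Setoid (≈-setoid {2})
      x E : ℚ
      x = inv 2 * H h
      E = ℕ→ℚ (2 ℕ.^ h) * ℕ→ℚ (2 ℕ.^ h)
      x∈ : ℤₚ x
      x∈ = ℤₚ-* (ℤₚ-inverse unit-2) (ℤₚ-H h h<p)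
      E∈ : ℤₚ E
      E∈ = ℤₚ-* (ℤₚ-ℕ (2 ℕ.^ h)) (ℤₚ-ℕ (2 ℕ.^ h))
      invert : ∀ e q x → e - (1ℚ + q * x) * (e * (1ℚ - q * x)) ≡ q * q * (e * x * x)
      invert = solve-∀ ℚ-ring
      halves : ∀ q x → (1ℚ + q * x) * (1ℚ - q * ((1ℚ + 1ℚ) * x)) - (1ℚ - q * x) ≡ q * q * - ((1ℚ + 1ℚ) * x * x)
      halves = solve-∀ ℚ-ring
      H≡2x : H h ≡ (1ℚ + 1ℚ) * x
      H≡2x = sym (trans (sym (ℚP.*-assoc (1ℚ + 1ℚ) (inv 2) (H h)))
                        (trans (cong (_* H h) (inverse unit-2)) (ℚP.*-identityˡ (H h))))
      correction : (1ℚ + P * x) * (1ℚ - P * H h) - (1ℚ - P * x) ≡ P * P * - ((1ℚ + 1ℚ) * x * x)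
      correction = trans (cong (λ y → (1ℚ + P * x) * (1ℚ - P * y) - (1ℚ - P * x)) H≡2x) (halves P x)

    fermat-quotient : qp2 p ≈ - (inv 2 * H h) [p^ 1 ]
    fermat-quotient = p*-cancel (begin
      P * qp2 p                                          ≡⟨ cancel-p P (inv p) (ℕ→ℚ (2 ℕ.^ (p ℕ.∸ 1))) ⟩
      (ℕ→ℚ (2 ℕ.^ (p ℕ.∸ 1)) - 1ℚ) * (inv p * P)         ≡⟨ cong₂ (λ y z → (y - 1ℚ) * z) 2^[p-1] inv-p*p ⟩
      (ℕ→ℚ (2 ℕ.^ h) * ℕ→ℚ (2 ℕ.^ h) - 1ℚ) * 1ℚ          ≡⟨ ℚP.*-identityʳ _ ⟩
      ℕ→ℚ (2 ℕ.^ h) * ℕ→ℚ (2 ℕ.^ h) + - 1ℚ              ≈⟨ +-cong four^h-expansion ≈-refl ⟩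
      1ℚ - P * (inv 2 * H h) + - 1ℚ                      ≡⟨ shift P (inv 2 * H h) ⟩
      P * - (inv 2 * H h)                                ∎)
      where
      open import Relation.Binary.Reasoning.Setoid (≈-setoid {2})
      shift : ∀ q x → 1ℚ - q * x + - 1ℚ ≡ q * - x
      shift = solve-∀ ℚ-ring
      cancel-p : ∀ q i y → q * ((y - 1ℚ) * i) ≡ (y - 1ℚ) * (i * q)
      cancel-p = solve-∀ ℚ-ring
      2^[p-1] : ℕ→ℚ (2 ℕ.^ (p ℕ.∸ 1)) ≡ ℕ→ℚ (2 ℕ.^ h) * ℕ→ℚ (2 ℕ.^ h)
      2^[p-1] = trans (cong (λ k → ℕ→ℚ (2 ℕ.^ (k ℕ.∸ 1))) p≡2h+1)
                      (trans (cong ℕ→ℚ (ℕP.^-distribˡ-+-* 2 h h)) (ℕ→ℚ-* (2 ℕ.^ h) (2 ℕ.^ h)))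

    ℤₚ-qp2 : ℤₚ (qp2 p)
    ℤₚ-qp2 = ℤₚ-≈ (ℤₚ-neg (ℤₚ-* (ℤₚ-inverse unit-2) (ℤₚ-H h h<p))) fermat-quotient

    2q≈-H : ℕ→ℚ 2 * qp2 p ≈ - H h [p^ 1 ]
    2q≈-H = subst (λ y → ℕ→ℚ 2 * qp2 p ≈ y [p^ 1 ]) halve (*-congˡ (ℕ→ℚ 2) (ℤₚ-ℕ 2) fermat-quotient)
      where
      regroup : ∀ t i x → t * - (i * x) ≡ - (t * i * x)
      regroup = solve-∀ ℚ-ring
      halve : ℕ→ℚ 2 * - (inv 2 * H h) ≡ - H h
      halve = trans (regroup (ℕ→ℚ 2) (inv 2) (H h))
                    (trans (cong (λ y → - (y * H h)) (inverse unit-2)) (cong -_ (ℚP.*-identityˡ (H h))))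

    module ResidueBelowHalf (a m : ℕ) (r+m≡h : suc a ℕ.+ m ≡ h) (t : ℚ) (t∈ : ℤₚ t) where

      r : ℕ
      r = suc a

      I : ℚ
      I = inv (h !)

      K : ℚ
      K = fac a * falling (- 1ℚ) m * falling (- ℕ→ℚ (suc r)) h

      S : ℚ
      S = H a + (0ℚ - H m) + (H (r ℕ.+ h) - H r)

      U : ℚ
      U = I * I * K

      I²∈ : ℤₚ (I * I)
      I²∈ = ℤₚ-* (ℤₚ-inverse (unit-fac h h<p)) (ℤₚ-inverse (unit-fac h h<p))

      r+h+m≡h+h : r ℕ.+ h ℕ.+ m ≡ h ℕ.+ h
      r+h+m≡h+h = trans (ℕP.+-assoc r h m) (trans (cong (r ℕ.+_) (ℕP.+-comm h m))
                    (trans (sym (ℕP.+-assoc r m h)) (cong (ℕ._+ h) r+m≡h)))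

      r+h<p : r ℕ.+ h < p
      r+h<p = ℕP.≤-<-trans (ℕP.≤-trans (ℕP.m≤m+n (r ℕ.+ h) m) (ℕP.≤-reflexive r+h+m≡h+h)) h+h<p

      r<p : r < p
      r<p = ℕP.≤-<-trans (ℕP.m≤m+n r h) r+h<p

      m<p : m < p
      m<p = ℕP.≤-<-trans (ℕP.m≤n+m m r) (subst (_< p) (sym r+m≡h) h<p)

      unit-r : Unitₚ (ℕ→ℚ r) (inv r)
      unit-r = unit-< r (ℕ.s≤s ℕ.z≤n) r<p

      binom-product≡ : binom (P * t + ℕ→ℚ r - 1ℚ) h * binom (- (P * t) - ℕ→ℚ r - 1ℚ) h
        ≡ P * (t * (I * I * (falling (ℕ→ℚ a + P * t) a * falling (- 1ℚ + P * t) m * falling (- ℕ→ℚ (suc r) + P * - t) h)))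
      binom-product≡ = begin
        falling y₁ h * I * (falling y₂ h * I)
          ≡⟨ cong₂ (λ u v → falling y₁ u * I * (falling v h * I)) (trans (sym r+m≡h) (sym (ℕP.+-suc a m))) y₂≡ ⟩
        falling y₁ (a ℕ.+ suc m) * I * (C * I)
          ≡⟨ cong (λ u → u * I * (C * I)) (falling-+ y₁ a (suc m)) ⟩
        falling y₁ a * falling (y₁ - ℕ→ℚ a) (suc m) * I * (C * I)
          ≡⟨ cong (λ u → falling y₁ a * u * I * (C * I)) (falling-suc (y₁ - ℕ→ℚ a) m) ⟩
        falling y₁ a * ((y₁ - ℕ→ℚ a) * falling (y₁ - ℕ→ℚ a - 1ℚ) m) * I * (C * I)
          ≡⟨ cong₂ (λ u v → falling u a * (v * falling (v - 1ℚ) m) * I * (C * I)) y₁≡ y₁-a≡ ⟩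
        A * (P * t * falling (P * t - 1ℚ) m) * I * (C * I)
          ≡⟨ cong (λ u → A * (P * t * falling u m) * I * (C * I)) (ℚP.+-comm (P * t) (- 1ℚ)) ⟩
        A * (P * t * B) * I * (C * I)
          ≡⟨ regroup A B C P t I ⟩
        P * (t * (I * I * (A * B * C)))  ∎
        where
        open ≡-Reasoning
        y₁ y₂ A B C : ℚ
        y₁ = P * t + ℕ→ℚ r - 1ℚ
        y₂ = - (P * t) - ℕ→ℚ r - 1ℚ
        A = falling (ℕ→ℚ a + P * t) a
        B = falling (- 1ℚ + P * t) m
        C = falling (- ℕ→ℚ (suc r) + P * - t) h
        shift₁ : ∀ x a → x + (a + 1ℚ) - 1ℚ ≡ a + x
        shift₁ = solve-∀ ℚ-ring
        shift₂ : ∀ x a → x + (a + 1ℚ) - 1ℚ - a ≡ x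
        shift₂ = solve-∀ ℚ-ring
        shift₃ : ∀ q t r → - (q * t) - r - 1ℚ ≡ - (r + 1ℚ) + q * - t
        shift₃ = solve-∀ ℚ-ring
        regroup : ∀ A B C q t i → A * (q * t * B) * i * (C * i) ≡ q * (t * (i * i * (A * B * C)))
        regroup = solve-∀ ℚ-ring
        y₁≡ : y₁ ≡ ℕ→ℚ a + P * t
        y₁≡ = trans (cong (λ u → P * t + u - 1ℚ) (ℕ→ℚ-suc a)) (shift₁ (P * t) (ℕ→ℚ a))
        y₁-a≡ : y₁ - ℕ→ℚ a ≡ P * t
        y₁-a≡ = trans (cong (λ u → P * t + u - 1ℚ - ℕ→ℚ a) (ℕ→ℚ-suc a)) (shift₂ (P * t) (ℕ→ℚ a))
        y₂≡ : y₂ ≡ - ℕ→ℚ (suc r) + P * - t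
        y₂≡ = trans (shift₃ P t (ℕ→ℚ r)) (cong (λ u → - u + P * - t) (sym (ℕ→ℚ-suc r)))

      factors-expansion : falling (ℕ→ℚ a + P * t) a * falling (- 1ℚ + P * t) m * falling (- ℕ→ℚ (suc r) + P * - t) h
        ≈ K * (1ℚ + P * t * S) [p^ 2 ]
      factors-expansion = expansion-* t∈ (ℤₚ-* (ℤₚ-ℕ (a !)) F₁∈) F₂∈ (ℤₚ-+ Ha∈ Hm∈) (ℤₚ-+ (ℤₚ-H (r ℕ.+ h) r+h<p) (ℤₚ-neg (ℤₚ-H r r<p)))
        (expansion-* t∈ (ℤₚ-ℕ (a !)) F₁∈ Ha∈ Hm∈
          (falling-ℕ-expansion a (ℕP.<-trans (ℕP.n<1+n a) r<p) t∈)
          (falling-neg-expansion 0 m m<p t∈))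
        (subst (λ y → falling (- ℕ→ℚ (suc r) + P * - t) h ≈ falling (- ℕ→ℚ (suc r)) h * y [p^ 2 ])
          (flip P t (H r) (H (r ℕ.+ h)))
          (falling-neg-expansion r h r+h<p (ℤₚ-neg t∈)))
        where
        flip : ∀ q t x y → 1ℚ + q * - t * (x - y) ≡ 1ℚ + q * t * (y - x)
        flip = solve-∀ ℚ-ring
        F₁∈ : ℤₚ (falling (- 1ℚ) m)
        F₁∈ = ℤₚ-falling m (ℤₚ-neg ℤₚ-1)
        F₂∈ : ℤₚ (falling (- ℕ→ℚ (suc r)) h)
        F₂∈ = ℤₚ-falling h (ℤₚ-neg (ℤₚ-ℕ (suc r)))
        Ha∈ : ℤₚ (H a)
        Ha∈ = ℤₚ-H a (ℕP.<-trans (ℕP.n<1+n a) r<p)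
        Hm∈ : ℤₚ (0ℚ - H m)
        Hm∈ = ℤₚ-+ ℤₚ-0 (ℤₚ-neg (ℤₚ-H m m<p))

      r*K≡ : ℕ→ℚ r * K ≡ sign h * fac (r ℕ.+ h) * falling (- 1ℚ) m
      r*K≡ = begin
        ℕ→ℚ r * (fac a * F₁ * F₂)      ≡⟨ regroup (ℕ→ℚ r) (fac a) F₁ F₂ ⟩
        F₂ * (ℕ→ℚ r * fac a) * F₁      ≡⟨ cong (λ y → F₂ * y * F₁) (fac-suc a) ⟨
        F₂ * fac r * F₁                ≡⟨ cong (_* F₁) (falling-neg r h) ⟩
        sign h * fac (r ℕ.+ h) * F₁    ∎
        where
        open ≡-Reasoning
        F₁ F₂ : ℚ
        F₁ = falling (- 1ℚ) m
        F₂ = falling (- ℕ→ℚ (suc r)) h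
        regroup : ∀ r f x y → r * (f * x * y) ≡ y * (r * f) * x
        regroup = solve-∀ ℚ-ring

      wilson-split : sign h * fac (h ℕ.+ h) ≈ ℕ→ℚ r * K * (1ℚ - P * H m) [p^ 2 ]
      wilson-split = begin
        sign h * fac (h ℕ.+ h)                                        ≡⟨ cong (λ k → sign h * fac k) r+h+m≡h+h ⟨
        sign h * fac (r ℕ.+ h ℕ.+ m)                                  ≡⟨ cong (sign h *_) (falling-ℕ-+ (r ℕ.+ h) m) ⟨
        sign h * (falling (ℕ→ℚ (r ℕ.+ h ℕ.+ m)) m * fac (r ℕ.+ h))   ≡⟨ cong (λ k → sign h * (falling (ℕ→ℚ k) m * fac (r ℕ.+ h))) r+h+m≡h+h ⟩
        sign h * (falling (ℕ→ℚ (h ℕ.+ h)) m * fac (r ℕ.+ h))          ≡⟨ swap (sign h) _ (fac (r ℕ.+ h)) ⟩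
        sign h * fac (r ℕ.+ h) * falling (ℕ→ℚ (h ℕ.+ h)) m            ≈⟨ *-congˡ (sign h * fac (r ℕ.+ h)) (ℤₚ-* (ℤₚ-sign h) (ℤₚ-ℕ ((r ℕ.+ h) !)))
                                                                           (wilson-expansion m m≤h+h) ⟩
        sign h * fac (r ℕ.+ h) * (sign m * fac m * (1ℚ - P * H m))    ≡⟨ cong (λ y → sign h * fac (r ℕ.+ h) * (y * (1ℚ - P * H m))) (falling-minus-one m) ⟨
        sign h * fac (r ℕ.+ h) * (falling (- 1ℚ) m * (1ℚ - P * H m))  ≡⟨ ℚP.*-assoc (sign h * fac (r ℕ.+ h)) (falling (- 1ℚ) m) (1ℚ - P * H m) ⟨
        sign h * fac (r ℕ.+ h) * falling (- 1ℚ) m * (1ℚ - P * H m)    ≡⟨ cong (_* (1ℚ - P * H m)) r*K≡ ⟨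
        ℕ→ℚ r * K * (1ℚ - P * H m)                                    ∎
        where
        open import Relation.Binary.Reasoning.Setoid (≈-setoid {2})
        swap : ∀ s x f → s * (x * f) ≡ s * f * x
        swap = solve-∀ ℚ-ring
        m≤h+h : m ≤ h ℕ.+ h
        m≤h+h = ℕP.≤-trans (ℕP.m≤n+m m (r ℕ.+ h)) (ℕP.≤-reflexive r+h+m≡h+h)

      2q∈ : ℤₚ (ℕ→ℚ 2 * qp2 p)
      2q∈ = ℤₚ-* (ℤₚ-ℕ 2) ℤₚ-qp2

      I*fac-h : I * fac h ≡ 1ℚ
      I*fac-h = trans (ℚP.*-comm I (fac h)) (inverse (unit-fac h h<p))

      U≈ : U ≈ inv r * (1ℚ + P * (ℕ→ℚ 2 * qp2 p + H m)) [p^ 2 ]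
      U≈ = ≈-inverse-expansion unit-r U∈ (ℤₚ-H m m<p) 2q∈ (begin
        ℕ→ℚ r * U * (1ℚ - P * H m)                       ≡⟨ regroup I (ℕ→ℚ r) K (1ℚ - P * H m) ⟩
        I * I * (ℕ→ℚ r * K * (1ℚ - P * H m))             ≈⟨ *-congˡ (I * I) I²∈ wilson-split ⟨
        I * I * (sign h * fac (h ℕ.+ h))                 ≈⟨ *-congˡ (I * I) I²∈ wilson-half ⟩
        I * I * (fac h * fac h * (1ℚ - P * H h))         ≡⟨ cancel I (fac h) (1ℚ - P * H h) ⟩
        I * fac h * (I * fac h) * (1ℚ - P * H h)         ≡⟨ cong (λ y → y * y * (1ℚ - P * H h)) I*fac-h ⟩
        1ℚ * 1ℚ * (1ℚ - P * H h)                         ≡⟨ neg-form P (H h) ⟩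
        1ℚ + P * - H h                                   ≈⟨ +-cong (≈-refl {_} {1ℚ}) (p*-cong 2q≈-H) ⟨
        1ℚ + P * (ℕ→ℚ 2 * qp2 p)                         ∎)
        where
        open import Relation.Binary.Reasoning.Setoid (≈-setoid {2})
        U∈ : ℤₚ U
        U∈ = ℤₚ-* I²∈ (ℤₚ-* (ℤₚ-* (ℤₚ-ℕ (a !)) (ℤₚ-falling m (ℤₚ-neg ℤₚ-1))) (ℤₚ-falling h (ℤₚ-neg (ℤₚ-ℕ (suc r)))))
        regroup : ∀ i r k y → r * (i * i * k) * y ≡ i * i * (r * k * y)
        regroup = solve-∀ ℚ-ring
        cancel : ∀ i f y → i * i * (f * f * y) ≡ i * f * (i * f) * y
        cancel = solve-∀ ℚ-ring
        neg-form : ∀ q x → 1ℚ * 1ℚ * (1ℚ - q * x) ≡ 1ℚ + q * - x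
        neg-form = solve-∀ ℚ-ring

      U*S≈ : U * S ≈ - (inv r * inv r) [p^ 1 ]
      U*S≈ = subst (λ y → U * S ≈ y [p^ 1 ]) (neg-square (inv r)) (*-cong (ℤₚ-inverse unit-r) S∈ U≈r S≈)
        where
        open import Relation.Binary.Reasoning.Setoid (≈-setoid {1})
        neg-square : ∀ i → i * - i ≡ - (i * i)
        neg-square = solve-∀ ℚ-ring
        drop : ∀ i q c → i * (1ℚ + q * c) - i ≡ q * (i * c)
        drop = solve-∀ ℚ-ring
        telescope : ∀ a m i → a + (0ℚ - m) + (m - (a + i)) ≡ - i
        telescope = solve-∀ ℚ-ring
        S∈ : ℤₚ S
        S∈ = ℤₚ-+ (ℤₚ-+ (ℤₚ-H a (ℕP.<-trans (ℕP.n<1+n a) r<p)) (ℤₚ-+ ℤₚ-0 (ℤₚ-neg (ℤₚ-H m m<p))))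
                  (ℤₚ-+ (ℤₚ-H (r ℕ.+ h) r+h<p) (ℤₚ-neg (ℤₚ-H r r<p)))
        U≈r : U ≈ inv r [p^ 1 ]
        U≈r = ≈-trans (≈-weaken U≈)
          (≈-p (inv r * (ℕ→ℚ 2 * qp2 p + H m)) (ℤₚ-* (ℤₚ-inverse unit-r) (ℤₚ-+ 2q∈ (ℤₚ-H m m<p))) (drop (inv r) P _))
        S≈ : S ≈ - inv r [p^ 1 ]
        S≈ = begin
          H a + (0ℚ - H m) + (H (r ℕ.+ h) - H r)   ≈⟨ +-cong (≈-refl {_} {H a + (0ℚ - H m)}) (+-cong (H-reflect (r ℕ.+ h) m r+h+m≡h+h) ≈-refl) ⟩
          H a + (0ℚ - H m) + (H m - H r)           ≡⟨ telescope (H a) (H m) (inv r) ⟩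
          - inv r                                  ∎

      binom-product-expansion : binom (P * t + ℕ→ℚ r - 1ℚ) h * binom (- (P * t) - ℕ→ℚ r - 1ℚ) h
        ≈ P * t * inv r + P * P * t * inv r * (ℕ→ℚ 2 * qp2 p + H m) - P * P * t * t * inv r * inv r [p^ 3 ]
      binom-product-expansion = begin
        binom (P * t + ℕ→ℚ r - 1ℚ) h * binom (- (P * t) - ℕ→ℚ r - 1ℚ) h
          ≡⟨ binom-product≡ ⟩
        P * (t * (I * I * (falling (ℕ→ℚ a + P * t) a * falling (- 1ℚ + P * t) m * falling (- ℕ→ℚ (suc r) + P * - t) h)))
          ≈⟨ p*-cong (*-congˡ t t∈ (*-congˡ (I * I) I²∈ factors-expansion)) ⟩
        P * (t * (I * I * (K * (1ℚ + P * t * S))))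
          ≡⟨ split P t I K S ⟩
        P * (t * U) + P * (t * (P * (t * (U * S))))
          ≈⟨ +-cong (p*-cong (*-congˡ t t∈ U≈)) (p*-cong (*-congˡ t t∈ (p*-cong (*-congˡ t t∈ U*S≈)))) ⟩
        P * (t * (inv r * (1ℚ + P * (ℕ→ℚ 2 * qp2 p + H m)))) + P * (t * (P * (t * - (inv r * inv r))))
          ≡⟨ collect P t (inv r) (ℕ→ℚ 2 * qp2 p + H m) ⟩
        P * t * inv r + P * P * t * inv r * (ℕ→ℚ 2 * qp2 p + H m) - P * P * t * t * inv r * inv r ∎
        where
        open import Relation.Binary.Reasoning.Setoid (≈-setoid {3})
        split : ∀ q t i k s → q * (t * (i * i * (k * (1ℚ + q * t * s)))) ≡ q * (t * (i * i * k)) + q * (t * (q * (t * (i * i * k * s))))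
        split = solve-∀ ℚ-ring
        collect : ∀ q t i c → q * (t * (i * (1ℚ + q * c))) + q * (t * (q * (t * - (i * i)))) ≡ q * t * i + q * q * t * i * c - q * q * t * t * i * i
        collect = solve-∀ ℚ-ring

    binom-product-expansion-above-half : ∀ r k t → suc h ℕ.+ k ≡ r → k < h → ℤₚ t →
      binom (P * t + ℕ→ℚ r - 1ℚ) h * binom (- (P * t) - ℕ→ℚ r - 1ℚ) h
        ≈ P * (t + 1ℚ) * inv r + P * P * (t + 1ℚ) * inv r * (ℕ→ℚ 2 * qp2 p + H k) - P * P * t * (t + 1ℚ) * inv r * inv r [p^ 3 ]
    binom-product-expansion-above-half r k t h+1+k≡r k<h t∈ = begin
      binom (P * t + ℕ→ℚ r - 1ℚ) h * binom (- (P * t) - ℕ→ℚ r - 1ℚ) h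
        ≡⟨ binom-product-reflect P t (ℕ→ℚ r) (ℕ→ℚ s) h R+S≡P ⟩
      binom (P * - (t + 1ℚ) + ℕ→ℚ s - 1ℚ) h * binom (- (P * - (t + 1ℚ)) - ℕ→ℚ s - 1ℚ) h
        ≈⟨ Reflected.binom-product-expansion ⟩
      P * - (t + 1ℚ) * inv s + P * P * - (t + 1ℚ) * inv s * c - P * P * - (t + 1ℚ) * - (t + 1ℚ) * inv s * inv s
        ≈⟨ reflection-rhs t c t∈ (ℤₚ-+ Reflected.2q∈ (ℤₚ-H k (ℕP.<-trans k<h h<p))) Reflected.unit-r unit-r R+S≡P ⟩
      P * (t + 1ℚ) * inv r + P * P * (t + 1ℚ) * inv r * c - P * P * t * (t + 1ℚ) * inv r * inv r ∎
      where
      open import Relation.Binary.Reasoning.Setoid (≈-setoid {3})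
      c : ℚ
      c = ℕ→ℚ 2 * qp2 p + H k
      a s : ℕ
      a = h ℕ.∸ suc k
      s = suc a
      s+k≡h : s ℕ.+ k ≡ h
      s+k≡h = trans (sym (ℕP.+-suc a k)) (ℕP.m∸n+n≡m k<h)
      r+s≡p : r ℕ.+ s ≡ p
      r+s≡p = trans (cong (ℕ._+ s) (sym h+1+k≡r))
                (trans (ℕP.+-assoc (suc h) k s) (trans (cong (suc h ℕ.+_) (trans (ℕP.+-comm k s) s+k≡h)) (sym p≡2h+1)))
      R+S≡P : ℕ→ℚ r + ℕ→ℚ s ≡ P
      R+S≡P = trans (sym (ℕ→ℚ-+ r s)) (cong ℕ→ℚ r+s≡p)
      unit-r : Unitₚ (ℕ→ℚ r) (inv r)
      unit-r = unit-< r (subst (0 <_) h+1+k≡r (ℕ.s≤s ℕ.z≤n)) (subst (r <_) r+s≡p (ℕP.m<m+n r (ℕ.s≤s ℕ.z≤n)))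
      module Reflected = ResidueBelowHalf a k s+k≡h (- (t + 1ℚ)) (ℤₚ-neg (ℤₚ-+ t∈ ℤₚ-1))

prime⇒odd : ∀ {p} → Prime p → 2 < p → p ≡ suc ((p ℕ.∸ 1) ℕ./ 2 ℕ.+ (p ℕ.∸ 1) ℕ./ 2)
prime⇒odd {zero} 0-prime _ = ⊥-elim (¬prime[0] 0-prime)
prime⇒odd {suc n} p-prime 2<p with n ℕ.% 2 | m%n<n n 2 | m≡m%n+[m/n]*n n 2
... | zero        | _                 | n≡ = cong suc (trans n≡ (double (n ℕ./ 2)))
  where
  double : ∀ k → k ℕ.* 2 ≡ k ℕ.+ k
  double = ℕ-Solver.solve-∀
... | suc zero    | _                 | n≡ with prime⇒irreducible p-prime (divides (suc (n ℕ./ 2)) (trans (cong suc n≡) (even (n ℕ./ 2))))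
  where
  even : ∀ k → suc (1 ℕ.+ k ℕ.* 2) ≡ suc k ℕ.* 2
  even = ℕ-Solver.solve-∀
...   | inj₁ ()
...   | inj₂ 2≡p = ⊥-elim (ℕP.<-irrefl 2≡p 2<p)
prime⇒odd {suc n} _ _ | suc (suc _) | ℕ.s≤s (ℕ.s≤s ()) | _

lemma2p1 : (p : ℕ) → Prime p → 3 < p →
    (r : ℕ) → 1 ≤ r → r < p →
    (t : ℚ) → pIntegral p t →
    let P = ℕ→ℚ p
        R = ℕ→ℚ r
        h = (p ℕ.∸ 1) ℕ./ 2
        lhs = binom (P * t + R - 1ℚ) h * binom (- (P * t) - R - 1ℚ) h
    in (2 ℕ.* r < p →
          CongMod lhs
            (P * t * inv r
              + P * P * t * inv r * (ℕ→ℚ 2 * qp2 p + H (h ℕ.∸ r))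
              - P * P * t * t * inv r * inv r)
            p 3)
     × (p < 2 ℕ.* r →
          CongMod lhs
            (P * (t + 1ℚ) * inv r
              + P * P * (t + 1ℚ) * inv r * (ℕ→ℚ 2 * qp2 p + H (r ℕ.∸ ((p ℕ.+ 1) ℕ./ 2)))
              - P * P * t * (t + 1ℚ) * inv r * inv r)
            p 3)
lemma2p1 p p-prime 3<p zero () _ _ _
lemma2p1 p p-prime 3<p (suc a) _ r<p t t∈ =
    (λ 2r<p → ≈⇒CongMod (ResidueBelowHalf.binom-product-expansion a (h ℕ.∸ suc a) (ℕP.m+[n∸m]≡n (below-half {suc a} 2r<p)) t (ℤₚ✓ t∈)))
  , (λ p<2r → ≈⇒CongMod (binom-product-expansion-above-half (suc a) k t (h+1+k≡r p<2r) (k<h p<2r) (ℤₚ✓ t∈)))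
  where
  h : ℕ
  h = (p ℕ.∸ 1) ℕ./ 2
  p≡2h+1 : p ≡ suc (h ℕ.+ h)
  p≡2h+1 = prime⇒odd p-prime (ℕP.<-trans (ℕP.n<1+n 2) 3<p)
  open Modulo p p-prime
  open OddPrime h p≡2h+1
  k : ℕ
  k = suc a ℕ.∸ ((p ℕ.+ 1) ℕ./ 2)
  h+1+k≡r : p < 2 ℕ.* suc a → suc h ℕ.+ k ≡ suc a
  h+1+k≡r p<2r = trans (cong (λ j → suc h ℕ.+ (suc a ℕ.∸ j)) [p+1]/2≡h+1) (ℕP.m+[n∸m]≡n (above-half {suc a} p<2r))
  k<h : p < 2 ℕ.* suc a → k < h
  k<h p<2r = ℕP.+-cancelˡ-< (suc h) k h (subst₂ _<_ (sym (h+1+k≡r p<2r)) p≡2h+1 r<p)
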